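{- Let $T$ be a tree with no regular cores and exactly two cores $u$ and $v$, both small. Then a set $L\subseteq V$ is a landmark set of $T$ if and only if $L$ contains a local set of $v$ (with respect to the three g-legs of $v$) and contains a local set of $u$ (with respect to the three g-legs of $u$). Moreover, every landmark set of $T$ that is minimal with respect to set inclusion contains at most one vertex of the path between $u$ and $v$ excluding $u$ and $v$, and at most two vertices of each long leg of $u$ and of each long leg of $v$.
   Context: Let $T=(V,E)$ be a finite tree and $d(x,y)$ the number of edges on the path between $x$ and $y$. A vertex $\tau$ separates $p$ and $q$ if $d(p,\tau)\neq d(q,\tau)$. A set $L\subseteq V$ is a landmark set if every pair of distinct vertices $p,q\in V\setminus L$ is separated by at least two vertices of $L$. A core is a vertex of degree at least $3$. For a vertex $v$, the subtrees of the neighbors of $v$ are the connected components of $T-v$. A (standard) leg of a core $v$ is a subtree of a neighbor of $v$ containing no core (a path attached to $v$); it is short if it has one vertex and long otherwise. For a leg $\ell$ of $v$, $\ell^i$ denotes the vertex of $\ell$ at distance $i$ from $v$ (its position is $i$). A small core is a core of degree exactly $3$ with at least two legs, at least one of which is short; other cores are regular. A modified leg of a core $v$ is a subtree of a neighbor of $v$ containing exactly one core, which is a small core $w$; the position of a vertex on it is its distance from $v$; if $w$ has position $i$, the two vertices of position $i+1$ are $\ell^a,\ell^b$, where $\ell^b$ is the vertex of a short leg of $w$ (chosen arbitrarily if both legs of $w$ inside $\ell$ are short). A g-leg of $v$ is a standard leg or a modified leg of $v$. In this statement $T$ consists of a path between $u$ and $v$ together with two standard legs at each of $u$ and $v$ (at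 least one short at each); each of $u,v$ has two standard legs and one modified leg (containing the other small core). Solution types. For a set $S$ and a standard leg $\ell$, $S\cap\ell$ is of type $(s,0)$ if empty; $(s,1)$ if it is a single vertex of position at least $2$; $(s,2)$ if it has at least two vertices; $(s,3)$ if it equals $\{\ell^1\}$. For a modified leg $\ell$ whose small core has position $i$: type $(m,1)$ if $S\cap\ell$ equals $\{\ell^a\}$ or $\{\ell^b\}$; type $(m,2)$ if it contains neither $\ell^a$ nor $\ell^b$ and contains at least two vertices of position at least $i+2$; type $(m,3)$ if it has at least two vertices, at least one of which is $\ell^a$ or $\ell^b$. A local set of a core $v$ is a set $S$ of vertices of the g-legs of $v$ (so $v\notin S$) such that: (1) at most one standard leg has type $(s,0)$ and all other standard legs have type $(s,1)$, $(s,2)$ or $(s,3)$; (2) every modified leg has type $(m,1)$, $(m,2)$ or $(m,3)$; (3) if some standard leg has type $(s,0)$ then no modified leg has type $(m,1)$; (4) if some long leg $\ell$ has type $(s,0)$ then every long leg other than $\ell$ has type $(s,2)$; (5) if some short leg has type $(s,0)$ then every long leg has type $(s,2)$ or $(s,3)$. "$L$ contains a local set of $v$" means some subset of $L$ is a local set of $v$. -}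

module Defs where

open import Data.Nat using (ℕ; zero; suc; _+_; _∸_; _≤_; _<_)
open import Data.Fin using (Fin; toℕ; fromℕ; inject₁)
  renaming (zero to fzero; suc to fsuc)
open import Data.Bool using (Bool; true; false)
open import Data.Product using (Σ; _×_; _,_; ∃)
open import Data.Sum using (_⊎_)
open import Data.Unit using (⊤)
open import Data.Empty using (⊥)
open import Relation.Nullary using (¬_)
open import Relation.Binary.PropositionalEquality using (_≡_; _≢_)

module Graph {V : Set} (Adj : V → V → Set) where

  data Walk : V → V → ℕ → Set where
    here : ∀ {x} → Walk x x 0
    step : ∀ {x y z n} → Adj x y → Walk y z n → Walk x z (suc n)

  Dist : V → V → ℕ → Set
  Dist x y n = Walk x y n × (∀ m → Walk x y m → n ≤ m)

  Subset : Set
  Subset = V → Bool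

  _∈_ : V → Subset → Set
  x ∈ S = S x ≡ true

  _∉_ : V → Subset → Set
  x ∉ S = S x ≡ false

  _⊆_ : Subset → Subset → Set
  S ⊆ L = ∀ x → x ∈ S → x ∈ L

  Separates : V → V → V → Set
  Separates τ p q = Σ ℕ λ m → Σ ℕ λ n → Dist p τ m × Dist q τ n × m ≢ n

  Landmark : Subset → Set
  Landmark L = ∀ p q → p ∉ L → q ∉ L → p ≢ q →
    Σ V λ τ₁ → Σ V λ τ₂ → τ₁ ≢ τ₂ × τ₁ ∈ L × τ₂ ∈ L ×
      Separates τ₁ p q × Separates τ₂ p q

  MinimalLandmark : Subset → Set
  MinimalLandmark L = Landmark L × (∀ L' → L' ⊆ L → Landmark L' → L ⊆ L')

  -- Solution types.
  -- A standard leg of length n is given by  leg : Fin n → V , where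
  -- leg j is the vertex of position (toℕ j + 1).

  module StdLeg (S : Subset) {n : ℕ} (leg : Fin n → V) where
    TypeS0 : Set
    TypeS0 = ∀ j → leg j ∉ S
    TypeS1 : Set
    TypeS1 = Σ (Fin n) λ j → leg j ∈ S × 2 ≤ suc (toℕ j) ×
               (∀ j' → leg j' ∈ S → j' ≡ j)
    TypeS2 : Set
    TypeS2 = Σ (Fin n) λ j → Σ (Fin n) λ j' → j ≢ j' × leg j ∈ S × leg j' ∈ S
    TypeS3 : Set
    TypeS3 = Σ (Fin n) λ j → toℕ j ≡ 0 × leg j ∈ S ×
               (∀ j' → leg j' ∈ S → j' ≡ j)

  -- A modified leg is given by its vertex set  In  and the position
  -- function  pos ; its small core has position i, so ℓ^a, ℓ^b are the
  -- two vertices of the leg with position i+1.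
  module ModLeg (S : Subset) (In : V → Set) (pos : V → ℕ) (i : ℕ) where
    TypeM1 : Set
    TypeM1 = Σ V λ x → In x × pos x ≡ suc i × x ∈ S ×
               (∀ y → In y → y ∈ S → y ≡ x)
    TypeM2 : Set
    TypeM2 = (∀ x → In x → pos x ≡ suc i → x ∉ S) ×
             (Σ V λ x → Σ V λ y → x ≢ y × In x × In y ×
                suc (suc i) ≤ pos x × suc (suc i) ≤ pos y × x ∈ S × y ∈ S)
    TypeM3 : Set
    TypeM3 = Σ V λ x → Σ V λ y → x ≢ y × In x × In y × x ∈ S × y ∈ S ×
               pos x ≡ suc i

  -- Local set of a core c with two standard legs (lengths len k, vertex
  -- maps leg k) and one modified leg (In, pos, small core at position i).
  IsLocal : (c : V) (len : Fin 2 → ℕ) (leg : (k : Fin 2) → Fin (len k) → V)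
            (In : V → Set) (pos : V → ℕ) (i : ℕ) → Subset → Set
  IsLocal c len leg In pos i S =
      c ∉ S
    -- (1)
    × (∀ k k' → S0 k → S0 k' → k ≡ k')
    × (∀ k → S0 k ⊎ S1 k ⊎ S2 k ⊎ S3 k)
    -- (2)
    × (M1 ⊎ M2 ⊎ M3)
    -- (3)
    × (∀ k → S0 k → ¬ M1)
    -- (4)
    × (∀ k → 2 ≤ len k → S0 k → ∀ k' → 2 ≤ len k' → k' ≢ k → S2 k')
    -- (5)
    × (∀ k → len k ≡ 1 → S0 k → ∀ k' → 2 ≤ len k' → S2 k' ⊎ S3 k')
    where
      S0 S1 S2 S3 : Fin 2 → Set
      S0 k = StdLeg.TypeS0 S (leg k)
      S1 k = StdLeg.TypeS1 S (leg k)
      S2 k = StdLeg.TypeS2 S (leg k)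
      S3 k = StdLeg.TypeS3 S (leg k)
      M1 M2 M3 : Set
      M1 = ModLeg.TypeM1 S In pos i
      M2 = ModLeg.TypeM2 S In pos i
      M3 = ModLeg.TypeM3 S In pos i

  ContainsLocal : (c : V) (len : Fin 2 → ℕ) (leg : (k : Fin 2) → Fin (len k) → V)
                  (In : V → Set) (pos : V → ℕ) (i : ℕ) → Subset → Set
  ContainsLocal c len leg In pos i L =
    Σ Subset λ S → S ⊆ L × IsLocal c len leg In pos i S

-- The tree: a path u = path 0, …, path p = v, with two standard legs at
-- u (lengths a 0, a 1) and two at v (lengths b 0, b 1).
-- uleg k j / vleg k j is the vertex of position toℕ j + 1 on leg k.

module TwoCoreTree (p : ℕ) (a b : Fin 2 → ℕ) where

  data V : Set where
    path : Fin (suc p) → V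
    uleg : (k : Fin 2) → Fin (a k) → V
    vleg : (k : Fin 2) → Fin (b k) → V

  u v : V
  u = path fzero
  v = path (fromℕ p)

  data Edge : V → V → Set where
    e-path : (i : Fin p) → Edge (path (inject₁ i)) (path (fsuc i))
    e-u    : (k : Fin 2) (j : Fin (a k)) → toℕ j ≡ 0 → Edge u (uleg k j)
    e-uu   : (k : Fin 2) (j j' : Fin (a k)) → suc (toℕ j) ≡ toℕ j' →
             Edge (uleg k j) (uleg k j')
    e-v    : (k : Fin 2) (j : Fin (b k)) → toℕ j ≡ 0 → Edge v (vleg k j)
    e-vv   : (k : Fin 2) (j j' : Fin (b k)) → suc (toℕ j) ≡ toℕ j' →
             Edge (vleg k j) (vleg k j')

  Adj : V → V → Set
  Adj x y = Edge x y ⊎ Edge y x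

  open Graph Adj public

  -- modified leg of v (the component of T - v containing u),
  -- position = distance from v
  InModV : V → Set
  InModV (path i)   = toℕ i < p
  InModV (uleg _ _) = ⊤
  InModV (vleg _ _) = ⊥

  posModV : V → ℕ
  posModV (path i)   = p ∸ toℕ i
  posModV (uleg _ j) = p + suc (toℕ j)
  posModV (vleg _ _) = 0

  -- modified leg of u (the component of T - u containing v),
  -- position = distance from u
  InModU : V → Set
  InModU (path i)   = 0 < toℕ i
  InModU (uleg _ _) = ⊥
  InModU (vleg _ _) = ⊤

  posModU : V → ℕ
  posModU (path i)   = toℕ i
  posModU (uleg _ _) = 0
  posModU (vleg _ j) = p + suc (toℕ j)

  -- L contains a local set of v / of u (w.r.t. their three g-legs);
  -- the small core inside the modified leg has position p.
  ContainsLocalV : Subset → Set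
  ContainsLocalV = ContainsLocal v b vleg InModV posModV p

  ContainsLocalU : Subset → Set
  ContainsLocalU = ContainsLocal u a uleg InModU posModU p

  AtMostOneInterior : Subset → Set
  AtMostOneInterior L = ∀ i i' → 0 < toℕ i → toℕ i < p → 0 < toℕ i' → toℕ i' < p →
    path i ∈ L → path i' ∈ L → i ≡ i'

  AtMostTwo : {n : ℕ} → (Fin n → V) → Subset → Set
  AtMostTwo {n} leg L = ∀ (j₁ j₂ j₃ : Fin n) → leg j₁ ∈ L → leg j₂ ∈ L → leg j₃ ∈ L →
    j₁ ≡ j₂ ⊎ j₁ ≡ j₃ ⊎ j₂ ≡ j₃

module Submission where

-- Such a tree is a caterpillar: the leg of u that is not the chosen
-- short leg, the u–v path and the analogous leg of v form one "spine", and
-- the two chosen short legs are single pendant vertices hanging at u and v.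
-- Give every vertex x a foot  f x  (its spine coordinate; the pendant
-- vertices sit above u resp. v) and an offset  o x ∈ {0,1}.  Then
--   d(x,y) = o x + o y + ∣ f x - f y ∣        for x ≢ y,
-- so τ separates x and y iff the profiles  E x t = o x + ∣ f x - t ∣  and
-- E y t differ at t = f τ.  The arithmetic heart of the proof
-- (profiles-agree-once) says that two different profiles agree at at most
-- one spine coordinate, unless x and y are "hanging neighbours" (a pendant
-- vertex and a spine vertex one step away from its foot).

open import Defs
open import Data.Nat using (ℕ; zero; suc; pred; _≟_; _+_; _∸_; _≤_; _<_; z≤n; s≤s; _<?_; _≤?_; ∣_-_∣)
open import Data.Nat.Properties
open import Data.Fin using (Fin; toℕ; fromℕ; fromℕ<; inject₁) renaming (zero to fzero; suc to fsuc; _≟_ to _≟F_)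
open import Data.Fin.Properties using (toℕ-injective; toℕ-fromℕ<; toℕ-inject₁; toℕ-fromℕ; toℕ<n; any?)
  renaming (<⇒≢ to fin-<⇒≢)
open import Data.Product using (Σ; _×_; _,_; proj₁; proj₂)
open import Data.Sum using (_⊎_; inj₁; inj₂; [_,_]′) renaming (map to ⊎-map; swap to ⊎-swap)
open import Data.Empty using (⊥; ⊥-elim)
open import Data.Unit using (tt)
open import Data.Bool using (true; false)
import Data.Bool as Bool
open import Relation.Nullary using (¬_; Dec; yes; no)
open import Relation.Nullary.Decidable using (¬?; _×-dec_; _⊎-dec_; toSum)
open import Relation.Binary.Definitions using (DecidableEquality; tri<; tri≈; tri>)
open import Function.Bundles using (_⇔_; mk⇔)
open import Relation.Binary.PropositionalEquality
open import Data.Nat.Tactic.RingSolver using (solve-∀)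

op : Fin 2 → Fin 2
op fzero = fsuc fzero
op (fsuc _) = fzero

op≢ : ∀ c → op c ≢ c
op≢ fzero ()
op≢ (fsuc fzero) ()

fin2 : ∀ (k k' k'' : Fin 2) → k ≢ k' → k'' ≡ k ⊎ k'' ≡ k'
fin2 fzero fzero _ ne = ⊥-elim (ne refl)
fin2 fzero (fsuc fzero) fzero _ = inj₁ refl
fin2 fzero (fsuc fzero) (fsuc fzero) _ = inj₂ refl
fin2 (fsuc fzero) fzero fzero _ = inj₂ refl
fin2 (fsuc fzero) fzero (fsuc fzero) _ = inj₁ refl
fin2 (fsuc fzero) (fsuc fzero) _ ne = ⊥-elim (ne refl)

which : ∀ c k → k ≡ c ⊎ k ≡ op c
which c k = fin2 c (op c) k (λ e → op≢ c (sym e))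

-- A view used to define the coordinates leg by leg: relative to the chosen
-- short leg c, a leg index is either c itself or the other leg.
data Side (c : Fin 2) : Fin 2 → Set where
  short : Side c c
  spine : Side c (op c)

side : ∀ c k → Side c k
side fzero fzero = short
side fzero (fsuc fzero) = spine
side (fsuc fzero) fzero = spine
side (fsuc fzero) (fsuc fzero) = short

side-op : ∀ c → side c (op c) ≡ spine
side-op fzero = refl
side-op (fsuc fzero) = refl

side-self : ∀ c → side c c ≡ short
side-self fzero = refl
side-self (fsuc fzero) = refl

∣n-sn∣ : ∀ n → ∣ n - suc n ∣ ≡ 1
∣n-sn∣ zero = refl
∣n-sn∣ (suc n) = ∣n-sn∣ n

∣sn-n∣ : ∀ n → ∣ suc n - n ∣ ≡ 1
∣sn-n∣ n = trans (∣-∣-comm (suc n) n) (∣n-sn∣ n)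

∣n+0-n∸1∣ : ∀ n → 1 ≤ n → ∣ n + 0 - n ∸ 1 ∣ ≡ 1
∣n+0-n∸1∣ (suc n) _ rewrite +-identityʳ n = ∣sn-n∣ n

∸-suc : ∀ m n → suc m ≤ n → n ∸ m ≡ suc (n ∸ suc m)
∸-suc zero (suc n) _ = refl
∸-suc (suc m) (suc n) (s≤s h) = ∸-suc m n h

∣∸∸∣ : ∀ t n → suc (suc t) ≤ n → ∣ n ∸ suc t - n ∸ suc (suc t) ∣ ≡ 1
∣∸∸∣ t n h rewrite ∸-suc (suc t) n h = ∣sn-n∣ (n ∸ suc (suc t))

swap+ : ∀ x y z → x + (y + z) ≡ y + (x + z)
swap+ x y z = trans (sym (+-assoc x y z)) (trans (cong (_+ z) (+-comm x y)) (+-assoc y x z))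

∸-lt : ∀ m n → n < m → m ∸ suc n < m
∸-lt (suc m) n _ = s≤s (m∸n≤m m n)

assoc-suc : ∀ A p t → suc (A + p + t) ≡ A + suc (p + t)
assoc-suc A p t = trans (cong suc (+-assoc A p t)) (sym (+-suc A (p + t)))

∸-of-sum : ∀ A n r → suc n + r ≡ A → A ∸ suc n ≡ r
∸-of-sum A n r eq = trans (cong (_∸ suc n) (sym eq)) (m+n∸m≡n (suc n) r)

suc-∸-+ : ∀ A t → suc t ≤ A → suc (A ∸ suc t) + t ≡ A
suc-∸-+ A t h = trans (sym (+-suc (A ∸ suc t) t)) (m∸n+n≡m h)

index-of-short : ∀ {n} (j : Fin n) → n ≡ 1 → toℕ j ≡ 0
index-of-short {n} j eq = lem (subst (toℕ j <_) eq (toℕ<n j))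
  where
  lem : ∀ {m} → m < 1 → m ≡ 0
  lem (s≤s z≤n) = refl

eq-up : ∀ F t → t ≤ F → suc ∣ F - t ∣ ≡ ∣ suc F - t ∣
eq-up F zero _ rewrite ∣-∣-identityʳ F = refl
eq-up (suc F) (suc t) (s≤s h) = eq-up F t h

ne-up : ∀ F t → F < t → suc ∣ F - t ∣ ≢ ∣ suc F - t ∣
ne-up zero (suc t) _ eq = lem t eq
  where
  lem : ∀ t → suc (suc t) ≢ ∣ zero - t ∣
  lem zero ()
  lem (suc t) eq = lem t (cong pred eq)
ne-up (suc F) (suc t) (s≤s h) = ne-up F t h

eq-down : ∀ F t → suc F ≤ t → suc ∣ suc F - t ∣ ≡ ∣ F - t ∣
eq-down F t h = trans (cong suc (∣-∣-comm (suc F) t)) (trans (eq-up' t F h) (∣-∣-comm t F))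
  where
  eq-up' : ∀ t F → suc F ≤ t → suc ∣ t - suc F ∣ ≡ ∣ t - F ∣
  eq-up' (suc t) zero _ rewrite ∣-∣-identityʳ t = refl
  eq-up' (suc t) (suc F) (s≤s h) = eq-up' t F h

ne-down : ∀ F t → t ≤ F → suc ∣ suc F - t ∣ ≢ ∣ F - t ∣
ne-down F zero _ eq rewrite ∣-∣-identityʳ F = lem F eq
  where
  lem : ∀ F → suc (suc F) ≢ F
  lem zero ()
  lem (suc F) eq = lem F (cong pred eq)
ne-down (suc F) (suc t) (s≤s h) = ne-down F t h

∣n-t∣≢∣sn-t∣ : ∀ n t → ∣ n - t ∣ ≢ ∣ suc n - t ∣
∣n-t∣≢∣sn-t∣ zero zero ()
∣n-t∣≢∣sn-t∣ zero (suc zero) ()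
∣n-t∣≢∣sn-t∣ zero (suc (suc t)) eq = 1+n≢n eq
∣n-t∣≢∣sn-t∣ (suc n) zero eq = 1+n≢n (sym eq)
∣n-t∣≢∣sn-t∣ (suc n) (suc t) eq = ∣n-t∣≢∣sn-t∣ n t eq

Agree : ℕ → ℕ → ℕ → ℕ → ℕ → Set
Agree ox fx oy fy t = ox + ∣ fx - t ∣ ≡ oy + ∣ fy - t ∣

∣t+e-t∣ : ∀ t e → ∣ t + e - t ∣ ≡ e
∣t+e-t∣ t e = trans (∣-∣-comm (t + e) t) (∣m-m+n∣≡n t e)

split-three : ∀ fx D t → (Σ ℕ λ e → t + e ≡ fx) ⊎ (Σ ℕ λ e → Σ ℕ λ e' → t ≡ fx + e × fx + D ≡ t + e') ⊎ (Σ ℕ λ e → t ≡ fx + D + e)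
split-three fx D t with ≤-total t fx
... | inj₁ h = inj₁ (fx ∸ t , m+[n∸m]≡n h)
... | inj₂ h with ≤-total t (fx + D)
...   | inj₁ h2 = inj₂ (inj₁ (t ∸ fx , fx + D ∸ t , sym (m+[n∸m]≡n h) , sym (m+[n∸m]≡n h2)))
...   | inj₂ h2 = inj₂ (inj₂ (t ∸ (fx + D) , sym (m+[n∸m]≡n h2)))

private
  offsets-too-close : ∀ x y D → x ≤ 1 → x ≡ y + suc (suc D) → ⊥
  offsets-too-close x y D h eq = m+n≮m 1 (y + D) (≤-trans (≤-reflexive (rearrange y D)) (≤-trans (≤-reflexive (sym eq)) h))
    where
    rearrange : ∀ y D → suc (1 + (y + D)) ≡ y + suc (suc D)
    rearrange = solve-∀

  -- If the feet are at least 2 apart, agreement only happens strictly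
  -- between them, at a point determined by the offsets.
  agree-between : ∀ ox oy fx D t → ox ≤ 1 → oy ≤ 1 → Agree ox fx oy (fx + suc (suc D)) t →
            Σ ℕ λ e → t ≡ fx + e × ox + (e + e) ≡ oy + suc (suc D)
  agree-between ox oy fx D t hx hy z with split-three fx (suc (suc D)) t
  ... | inj₁ (e , refl) = ⊥-elim (offsets-too-close ox oy D hx (+-cancelʳ-≡ e ox (oy + suc (suc D)) z'))
    where
    z' : ox + e ≡ oy + suc (suc D) + e
    z' = trans (cong (ox +_) (sym (∣t+e-t∣ t e))) (trans z (trans (cong (λ q → oy + ∣ q - t ∣) (s1 t e D)) (trans (cong (oy +_) (∣t+e-t∣ t (e + suc (suc D)))) (s2 oy e D))))
      where
      s1 : ∀ t e D → t + e + suc (suc D) ≡ t + (e + suc (suc D))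
      s1 = solve-∀
      s2 : ∀ oy e D → oy + (e + suc (suc D)) ≡ oy + suc (suc D) + e
      s2 = solve-∀
  ... | inj₂ (inj₂ (e , refl)) = ⊥-elim (offsets-too-close oy ox D hy (sym (+-cancelʳ-≡ e (ox + suc (suc D)) oy z')))
    where
    z' : ox + suc (suc D) + e ≡ oy + e
    z' = trans (s2 ox e D) (trans (cong (ox +_) (sym (trans (cong (λ q → ∣ fx - q ∣) (+-assoc fx (suc (suc D)) e)) (∣m-m+n∣≡n fx _)))) (trans z (cong (oy +_) (∣m-m+n∣≡n (fx + suc (suc D)) e))))
      where
      s2 : ∀ ox e D → ox + suc (suc D) + e ≡ ox + (suc (suc D) + e)
      s2 = solve-∀
  ... | inj₂ (inj₁ (e , e' , refl , eq)) = e , refl , res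
    where
    z1 : ox + e ≡ oy + e'
    z1 = trans (cong (ox +_) (sym (∣m-m+n∣≡n fx e))) (trans z (cong (oy +_) (trans (cong (λ q → ∣ q - fx + e ∣) eq) (∣t+e-t∣ (fx + e) e'))))
    dd : suc (suc D) ≡ e + e'
    dd = +-cancelˡ-≡ fx _ _ (trans eq (+-assoc fx e e'))
    res : ox + (e + e) ≡ oy + suc (suc D)
    res = trans (sym (+-assoc ox e e)) (trans (cong (_+ e) z1) (trans (s3 oy e' e) (cong (oy +_) (sym dd))))
      where
      s3 : ∀ oy e' e → oy + e' + e ≡ oy + (e + e')
      s3 = solve-∀

  half-injective : ∀ e g → e + e ≡ g + g → e ≡ g
  half-injective zero zero _ = refl
  half-injective zero (suc g) ()
  half-injective (suc e) zero ()
  half-injective (suc e) (suc g) eq = cong suc (half-injective e g (cong pred (trans (sym (+-suc e e)) (trans (cong pred eq) (+-suc g g)))))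

  agree-once-ordered : ∀ fx D ox oy t t' → ox ≤ 1 → oy ≤ 1 → ¬ (D ≡ 0 × ox ≡ oy) →
           Agree ox fx oy (fx + D) t → Agree ox fx oy (fx + D) t' → t ≡ t' ⊎ (ox ≢ oy × D ≡ 1)
  agree-once-ordered fx zero ox oy t t' hx hy nd z z' rewrite +-identityʳ fx = ⊥-elim (nd (refl , +-cancelʳ-≡ _ ox oy z))
  agree-once-ordered fx (suc zero) ox oy t t' hx hy nd z z' with ox ≟ oy
  ... | no ne = inj₂ (ne , refl)
  ... | yes refl = ⊥-elim (∣n-t∣≢∣sn-t∣ fx t (trans (+-cancelˡ-≡ ox _ _ z) (cong (λ q → ∣ q - t ∣) (+-comm fx 1))))
  agree-once-ordered fx (suc (suc D)) ox oy t t' hx hy nd z z' with agree-between ox oy fx D t hx hy z | agree-between ox oy fx D t' hx hy z'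
  ... | e , refl , r1 | g , refl , r2 = inj₁ (cong (fx +_) (half-injective e g (+-cancelˡ-≡ ox _ _ (trans r1 (sym r2)))))

profiles-agree-once : ∀ fx fy ox oy t t' → ox ≤ 1 → oy ≤ 1 → ¬ (fx ≡ fy × ox ≡ oy) →
     Agree ox fx oy fy t → Agree ox fx oy fy t' → t ≡ t' ⊎ (ox ≢ oy × (suc fx ≡ fy ⊎ suc fy ≡ fx))
profiles-agree-once fx fy ox oy t t' hx hy nd z z' with ≤-total fx fy
... | inj₁ h with agree-once-ordered fx (fy ∸ fx) ox oy t t' hx hy (λ { (d0 , e) → nd (trans (sym (+-identityʳ fx)) (trans (cong (fx +_) (sym d0)) (m+[n∸m]≡n h)) , e) })
                   (subst (λ q → Agree ox fx oy q t) (sym (m+[n∸m]≡n h)) z) (subst (λ q → Agree ox fx oy q t') (sym (m+[n∸m]≡n h)) z')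
...   | inj₁ tt' = inj₁ tt'
...   | inj₂ (ne , d1) = inj₂ (ne , inj₁ (trans (trans (+-comm 1 fx) (cong (fx +_) (sym d1))) (m+[n∸m]≡n h)))
profiles-agree-once fx fy ox oy t t' hx hy nd z z' | inj₂ h with agree-once-ordered fy (fx ∸ fy) oy ox t t' hy hx (λ { (d0 , e) → nd (sym (trans (sym (+-identityʳ fy)) (trans (cong (fy +_) (sym d0)) (m+[n∸m]≡n h))) , sym e) })
                   (subst (λ q → Agree oy fy ox q t) (sym (m+[n∸m]≡n h)) (sym z)) (subst (λ q → Agree oy fy ox q t') (sym (m+[n∸m]≡n h)) (sym z'))
...   | inj₁ tt' = inj₁ tt'
...   | inj₂ (ne , d1) = inj₂ ((λ e → ne (sym e)) , inj₂ (trans (trans (+-comm 1 fy) (cong (fy +_) (sym d1))) (m+[n∸m]≡n h)))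

pick3 : ∀ {n} (P : Fin n → Set) (j1 j2 j3 : Fin n) → P j1 → P j2 → P j3 → j1 ≢ j2 → j1 ≢ j3 → j2 ≢ j3 →
  Σ (Fin n) λ m → Σ (Fin n) λ r1 → Σ (Fin n) λ r2 → P m × P r1 × P r2 × r1 ≢ r2 × toℕ r1 < toℕ m × toℕ r2 < toℕ m
pick3 P j1 j2 j3 h1 h2 h3 n12 n13 n23 with <-cmp (toℕ j1) (toℕ j2)
... | tri≈ _ e _ = ⊥-elim (n12 (toℕ-injective e))
... | tri< l12 _ _ with <-cmp (toℕ j2) (toℕ j3)
...   | tri≈ _ e _ = ⊥-elim (n23 (toℕ-injective e))
...   | tri< l23 _ _ = j3 , j1 , j2 , h3 , h1 , h2 , n12 , <-trans l12 l23 , l23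
...   | tri> _ _ l32 = j2 , j1 , j3 , h2 , h1 , h3 , n13 , l12 , l32
pick3 P j1 j2 j3 h1 h2 h3 n12 n13 n23 | tri> _ _ l21 with <-cmp (toℕ j1) (toℕ j3)
...   | tri≈ _ e _ = ⊥-elim (n13 (toℕ-injective e))
...   | tri< l13 _ _ = j3 , j1 , j2 , h3 , h1 , h2 , n12 , l13 , <-trans l21 l13
...   | tri> _ _ l31 = j1 , j2 , j3 , h1 , h2 , h3 , n23 , l21 , l31

at-most-two : ∀ {n} (P : Fin n → Set) →
  (∀ m r1 r2 → P m → P r1 → P r2 → r1 ≢ r2 → toℕ r1 < toℕ m → toℕ r2 < toℕ m → ⊥) →
  ∀ j1 j2 j3 → P j1 → P j2 → P j3 → j1 ≡ j2 ⊎ j1 ≡ j3 ⊎ j2 ≡ j3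
at-most-two P no-three j1 j2 j3 h1 h2 h3 with j1 ≟F j2 | j1 ≟F j3 | j2 ≟F j3
... | yes e | _ | _ = inj₁ e
... | no _ | yes e | _ = inj₂ (inj₁ e)
... | no _ | no _ | yes e = inj₂ (inj₂ e)
... | no n12 | no n13 | no n23 with pick3 P j1 j2 j3 h1 h2 h3 n12 n13 n23
...   | m , r1 , r2 , hm , hr1 , hr2 , r1≢r2 , l1 , l2 = ⊥-elim (no-three m r1 r2 hm hr1 hr2 r1≢r2 l1 l2)

true≢false : true ≢ false
true≢false ()

¬∈⇒∉ : ∀ {b} → ¬ (b ≡ true) → b ≡ false
¬∈⇒∉ {false} _ = refl
¬∈⇒∉ {true} h = ⊥-elim (h refl)

module Deletion {V : Set} (Adj : V → V → Set) (_≟V_ : DecidableEquality V) where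
  open Graph Adj

  ∉≢∈ : ∀ {L : Subset} {x τ} → x ∉ L → τ ∈ L → x ≢ τ
  ∉≢∈ hx hτ refl = true≢false (trans (sym hτ) hx)

  delete : V → Subset → Subset
  delete w S x with x ≟V w
  ... | yes _ = false
  ... | no _ = S x

  delete-self : ∀ w S → w ∉ delete w S
  delete-self w S with w ≟V w
  ... | yes _ = refl
  ... | no ne = ⊥-elim (ne refl)

  delete-other : ∀ w S x → x ≢ w → delete w S x ≡ S x
  delete-other w S x ne with x ≟V w
  ... | yes e = ⊥-elim (ne e)
  ... | no _ = refl

  delete-∈ : ∀ w S x → x ≢ w → x ∈ S → x ∈ delete w S
  delete-∈ w S x ne h = trans (delete-other w S x ne) h

  delete-∉ : ∀ w S x → x ∉ S → x ∉ delete w S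
  delete-∉ w S x h with x ≟V w
  ... | yes _ = refl
  ... | no _ = h

  delete-⊆ : ∀ w S → delete w S ⊆ S
  delete-⊆ w S x h with x ≟V w
  ... | yes _ = ⊥-elim (true≢false (sym h))
  ... | no _ = h

  delete-mono : ∀ w S L → S ⊆ L → delete w S ⊆ delete w L
  delete-mono w S L sub x h with x ≟V w
  ... | yes _ = h
  ... | no _ = sub x h

  classify : ∀ (S : Subset) {n} (leg : Fin n → V) →
    StdLeg.TypeS0 S leg ⊎ StdLeg.TypeS1 S leg ⊎ StdLeg.TypeS2 S leg ⊎ StdLeg.TypeS3 S leg
  classify S leg with any? (λ j → S (leg j) Bool.≟ true)
  ... | no none = inj₁ (λ j → ¬∈⇒∉ (λ h → none (j , h)))
  ... | yes (j , h) with any? (λ j' → ¬? (j' ≟F j) ×-dec (S (leg j') Bool.≟ true))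
  ...   | yes (j' , ne , h') = inj₂ (inj₂ (inj₁ (j , j' , (λ e → ne (sym e)) , h , h')))
  ...   | no none = [ (λ z → inj₂ (inj₂ (inj₂ (j , z , h , unique))))
                    , (λ nz → inj₂ (inj₁ (j , h , s≤s (n≢0⇒n>0 nz) , unique))) ]′ (toSum (toℕ j ≟ 0))
    where
    unique : ∀ j' → leg j' ∈ S → j' ≡ j
    unique j' h' with j' ≟F j
    ... | yes e = e
    ... | no ne = ⊥-elim (none (j' , ne , h'))

  ModTypes : Subset → (V → Set) → (V → ℕ) → ℕ → Set
  ModTypes S In pos i = ModLeg.TypeM1 S In pos i ⊎ ModLeg.TypeM2 S In pos i ⊎ ModLeg.TypeM3 S In pos i

  -- How the type of one standard leg can change from S to S' without
  -- breaking the local-set conditions.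
  StdTransfer : Subset → Subset → ∀ {n} → (Fin n → V) → Set
  StdTransfer S S' leg = (StdLeg.TypeS0 S' leg → StdLeg.TypeS0 S leg)
                       × (StdLeg.TypeS2 S leg → StdLeg.TypeS2 S' leg)
                       × (StdLeg.TypeS3 S leg → StdLeg.TypeS3 S' leg)

  local-transfer : ∀ c len (leg : (k : Fin 2) → Fin (len k) → V) In pos i S S' →
    IsLocal c len leg In pos i S → c ∉ S' → (∀ k → StdTransfer S S' (leg k)) →
    ModTypes S' In pos i → (ModLeg.TypeM1 S' In pos i → ModLeg.TypeM1 S In pos i) →
    IsLocal c len leg In pos i S'
  local-transfer c len leg In pos i S S' (_ , c1 , _ , _ , c3 , c4 , c5) c∉ t m m1 =
      c∉
    , (λ k k' z z' → c1 k k' (s0 k z) (s0 k' z'))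
    , (λ k → classify S' (leg k))
    , m
    , (λ k z m1' → c3 k (s0 k z) (m1 m1'))
    , (λ k hk z k' hk' ne → s2 k' (c4 k hk (s0 k z) k' hk' ne))
    , (λ k hk z k' hk' → ⊎-map (s2 k') (s3 k') (c5 k hk (s0 k z) k' hk'))
    where
    s0 : ∀ k → StdLeg.TypeS0 S' (leg k) → StdLeg.TypeS0 S (leg k)
    s0 k = proj₁ (t k)
    s2 : ∀ k → StdLeg.TypeS2 S (leg k) → StdLeg.TypeS2 S' (leg k)
    s2 k = proj₁ (proj₂ (t k))
    s3 : ∀ k → StdLeg.TypeS3 S (leg k) → StdLeg.TypeS3 S' (leg k)
    s3 k = proj₂ (proj₂ (t k))

  std-unchanged : ∀ {n} (leg : Fin n → V) S S' → (∀ j → S' (leg j) ≡ S (leg j)) → StdTransfer S S' leg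
  std-unchanged leg S S' eq =
      (λ z j → trans (sym (eq j)) (z j))
    , (λ { (j , j' , ne , h , h') → j , j' , ne , trans (eq j) h , trans (eq j') h' })
    , (λ { (j , z , h , uq) → j , z , trans (eq j) h , λ j' h' → uq j' (trans (sym (eq j')) h') })

  std-keeps-two : ∀ {n} (leg : Fin n → V) S S' (r1 r2 : Fin n) → r1 ≢ r2 → leg r1 ∈ S' → leg r2 ∈ S' →
    leg r1 ∈ S → leg r2 ∈ S → StdTransfer S S' leg
  std-keeps-two leg S S' r1 r2 ne h1' h2' h1 h2 =
      (λ z → ⊥-elim (true≢false (trans (sym h1') (z r1))))
    , (λ _ → r1 , r2 , ne , h1' , h2')
    , (λ { (j , z , h , uq) → ⊥-elim (ne (trans (uq r1 h1) (sym (uq r2 h2)))) })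

  mod-unchanged : ∀ In pos i S S' → (∀ x → In x → S' x ≡ S x) →
    (ModTypes S In pos i → ModTypes S' In pos i) × (ModLeg.TypeM1 S' In pos i → ModLeg.TypeM1 S In pos i)
  mod-unchanged In pos i S S' eq =
      (λ { (inj₁ (x , ix , px , hx , uq)) → inj₁ (x , ix , px , trans (eq x ix) hx , λ y iy hy → uq y iy (trans (sym (eq y iy)) hy))
         ; (inj₂ (inj₁ (nf , x , y , ne , ix , iy , px , py , hx , hy))) →
              inj₂ (inj₁ ((λ z iz pz → trans (eq z iz) (nf z iz pz)) , x , y , ne , ix , iy , px , py , trans (eq x ix) hx , trans (eq y iy) hy))
         ; (inj₂ (inj₂ (x , y , ne , ix , iy , hx , hy , px))) → inj₂ (inj₂ (x , y , ne , ix , iy , trans (eq x ix) hx , trans (eq y iy) hy , px)) })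
    , (λ { (x , ix , px , hx , uq) → x , ix , px , trans (sym (eq x ix)) hx , λ y iy hy → uq y iy (trans (eq y iy) hy) })

  mod-delete-near : ∀ In pos i S w y → ModTypes S In pos i → y ∈ S → In y → y ≢ w → w ∈ S → In w → pos w ≤ i → pos y ≤ i →
    ModTypes (delete w S) In pos i × ¬ ModLeg.TypeM1 (delete w S) In pos i
  mod-delete-near In pos i S w y m hy iy yw hw iw pw py = res m , m1
    where
    notW : ∀ x → suc i ≤ pos x → x ≢ w
    notW x h refl = 1+n≰n (≤-trans h pw)
    res : ModTypes S In pos i → ModTypes (delete w S) In pos i
    res (inj₁ (x , ix , px , hx , uq)) = ⊥-elim (yw (trans (uq y iy hy) (sym (uq w iw hw))))
    res (inj₂ (inj₁ (nf , x1 , x2 , ne , i1 , i2 , p1 , p2 , h1 , h2))) =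
      inj₂ (inj₁ ((λ z iz pz → delete-∉ w S z (nf z iz pz)) , x1 , x2 , ne , i1 , i2 , p1 , p2 ,
             delete-∈ w S x1 (notW x1 (≤-trans (n≤1+n _) p1)) h1 , delete-∈ w S x2 (notW x2 (≤-trans (n≤1+n _) p2)) h2))
    res (inj₂ (inj₂ (x1 , x2 , ne , i1 , i2 , h1 , h2 , p1))) with x2 ≟V w
    ... | no n2 = inj₂ (inj₂ (x1 , x2 , ne , i1 , i2 , delete-∈ w S x1 (notW x1 (≤-reflexive (sym p1))) h1 , delete-∈ w S x2 n2 h2 , p1))
    ... | yes _ = inj₂ (inj₂ (x1 , y , (λ e → 1+n≰n (≤-trans (≤-reflexive (trans (sym p1) (cong pos e))) py)) , i1 , iy ,
                   delete-∈ w S x1 (notW x1 (≤-reflexive (sym p1))) h1 , delete-∈ w S y yw hy , p1))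
    m1 : ¬ ModLeg.TypeM1 (delete w S) In pos i
    m1 (x , ix , px , hx , uq) = 1+n≰n (≤-trans (≤-reflexive (trans (sym px) (cong pos (sym (uq y iy (delete-∈ w S y yw hy)))))) py)

  mod-delete-far : ∀ In pos i S w r1 r2 → ModTypes S In pos i → r1 ≢ r2 → r1 ∈ S → r2 ∈ S → In r1 → In r2 → r1 ≢ w → r2 ≢ w →
    suc (suc i) ≤ pos w → (pos r1 ≡ suc i ⊎ suc (suc i) ≤ pos r1) → (pos r2 ≡ suc i ⊎ suc (suc i) ≤ pos r2) →
    ModTypes (delete w S) In pos i × ¬ ModLeg.TypeM1 (delete w S) In pos i
  mod-delete-far In pos i S w r1 r2 m n12 h1 h2 i1 i2 n1 n2 pw q1 q2 = res m , m1
    where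
    notW : ∀ x → pos x ≡ suc i → x ≢ w
    notW x e refl = 1+n≰n (≤-trans pw (≤-reflexive e))
    res : ModTypes S In pos i → ModTypes (delete w S) In pos i
    res (inj₁ (x , ix , px , hx , uq)) = ⊥-elim (n12 (trans (uq r1 i1 h1) (sym (uq r2 i2 h2))))
    res (inj₂ (inj₁ (nf , _))) = inj₂ (inj₁ ((λ z iz pz → delete-∉ w S z (nf z iz pz)) , r1 , r2 , n12 , i1 , i2 , far r1 i1 h1 q1 , far r2 i2 h2 q2 ,
                                   delete-∈ w S r1 n1 h1 , delete-∈ w S r2 n2 h2))
      where
      far : ∀ r → In r → r ∈ S → (pos r ≡ suc i ⊎ suc (suc i) ≤ pos r) → suc (suc i) ≤ pos r
      far r ir hr (inj₁ e) = ⊥-elim (true≢false (trans (sym hr) (nf r ir e)))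
      far r ir hr (inj₂ le) = le
    res (inj₂ (inj₂ (x1 , x2 , ne , ix1 , ix2 , hx1 , hx2 , p1))) with x2 ≟V w
    ... | no nx2 = inj₂ (inj₂ (x1 , x2 , ne , ix1 , ix2 , delete-∈ w S x1 (notW x1 p1) hx1 , delete-∈ w S x2 nx2 hx2 , p1))
    ... | yes _ with r1 ≟V x1
    ...   | no nr1 = inj₂ (inj₂ (x1 , r1 , (λ e → nr1 (sym e)) , ix1 , i1 , delete-∈ w S x1 (notW x1 p1) hx1 , delete-∈ w S r1 n1 h1 , p1))
    ...   | yes e = inj₂ (inj₂ (x1 , r2 , (λ e' → n12 (trans e e')) , ix1 , i2 , delete-∈ w S x1 (notW x1 p1) hx1 , delete-∈ w S r2 n2 h2 , p1))
    m1 : ¬ ModLeg.TypeM1 (delete w S) In pos i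
    m1 (x , ix , px , hx , uq) = n12 (trans (uq r1 i1 (delete-∈ w S r1 n1 h1)) (sym (uq r2 i2 (delete-∈ w S r2 n2 h2))))

module WalkOps {V : Set} (Adj : V → V → Set) (adj-sym : ∀ {x y} → Adj x y → Adj y x) where
  open Graph Adj

  snoc : ∀ {x y z n} → Walk x y n → Adj y z → Walk x z (suc n)
  snoc here e = step e here
  snoc (step e' w) e = step e' (snoc w e)

  reverse : ∀ {x y n} → Walk x y n → Walk y x n
  reverse here = here
  reverse (step e w) = snoc (reverse w) (adj-sym e)

  _++w_ : ∀ {x y z m n} → Walk x y m → Walk y z n → Walk x z (m + n)
  here ++w w = w
  step e w ++w w' = step e (w ++w w')

module LandmarkFacts {V : Set} (Adj : V → V → Set) where
  open Graph Adj

  separators-not-unique : ∀ {L} → Landmark L → ∀ {x y} → x ∉ L → y ∉ L → x ≢ y →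
    ∀ z → ¬ (∀ τ → τ ∈ L → Separates τ x y → τ ≡ z)
  separators-not-unique lm hx hy ne z only-z with lm _ _ hx hy ne
  ... | τ₁ , τ₂ , τ₁≢τ₂ , h₁ , h₂ , s₁ , s₂ = τ₁≢τ₂ (trans (only-z τ₁ h₁ s₁) (sym (only-z τ₂ h₂ s₂)))

  some-separator : ∀ {L} → Landmark L → ∀ {x y} → x ∉ L → y ∉ L → x ≢ y →
    ¬ (∀ τ → τ ∈ L → ¬ Separates τ x y)
  some-separator lm hx hy ne none with lm _ _ hx hy ne
  ... | τ₁ , _ , _ , h₁ , _ , s₁ , _ = none τ₁ h₁ s₁

module LocalSetFacts {V : Set} (Adj : V → V → Set) where
  open Graph Adj

  ∉-⊆ : ∀ {S L : Subset} {x} → S ⊆ L → x ∉ L → x ∉ S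
  ∉-⊆ {x = x} sub hx = ¬∈⇒∉ (λ h → true≢false (trans (sym (sub x h)) hx))

  private
    variable
      c : V
      len : Fin 2 → ℕ
      leg : (k : Fin 2) → Fin (len k) → V
      In : V → Set
      pos : V → ℕ
      i : ℕ
      S : Subset

  one-empty : IsLocal c len leg In pos i S → ∀ k k' → StdLeg.TypeS0 S (leg k) → StdLeg.TypeS0 S (leg k') → k ≡ k'
  one-empty (_ , c1 , _) = c1

  empty-excludes-m1 : IsLocal c len leg In pos i S → ∀ k → StdLeg.TypeS0 S (leg k) → ¬ ModLeg.TypeM1 S In pos i
  empty-excludes-m1 (_ , _ , _ , _ , c3 , _) = c3

  short-empty : IsLocal c len leg In pos i S → ∀ k → len k ≡ 1 → StdLeg.TypeS0 S (leg k) → ∀ k' → 2 ≤ len k' →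
                StdLeg.TypeS2 S (leg k') ⊎ StdLeg.TypeS3 S (leg k')
  short-empty (_ , _ , _ , _ , _ , _ , c5) = c5

  leg-meets : IsLocal c len leg In pos i S → ∀ k → StdLeg.TypeS0 S (leg k) ⊎ Σ (Fin (len k)) λ j → leg k j ∈ S
  leg-meets (_ , _ , types , _) k with types k
  ... | inj₁ z = inj₁ z
  ... | inj₂ (inj₁ (j , h , _)) = inj₂ (j , h)
  ... | inj₂ (inj₂ (inj₁ (j , _ , _ , h , _))) = inj₂ (j , h)
  ... | inj₂ (inj₂ (inj₂ (j , _ , h , _))) = inj₂ (j , h)

  mod-meets : IsLocal c len leg In pos i S → Σ V λ x → In x × x ∈ S
  mod-meets (_ , _ , _ , inj₁ (x , ix , _ , hx , _) , _) = x , ix , hx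
  mod-meets (_ , _ , _ , inj₂ (inj₁ (_ , x , _ , _ , ix , _ , _ , _ , hx , _)) , _) = x , ix , hx
  mod-meets (_ , _ , _ , inj₂ (inj₂ (x , _ , _ , ix , _ , hx , _)) , _) = x , ix , hx

  mod-meets-twice : IsLocal c len leg In pos i S → ¬ ModLeg.TypeM1 S In pos i →
                    Σ V λ x → Σ V λ y → x ≢ y × In x × In y × x ∈ S × y ∈ S
  mod-meets-twice (_ , _ , _ , inj₁ m , _) n = ⊥-elim (n m)
  mod-meets-twice (_ , _ , _ , inj₂ (inj₁ (_ , x , y , ne , ix , iy , _ , _ , hx , hy)) , _) _ = x , y , ne , ix , iy , hx , hy
  mod-meets-twice (_ , _ , _ , inj₂ (inj₂ (x , y , ne , ix , iy , hx , hy , _)) , _) _ = x , y , ne , ix , iy , hx , hy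

-- 2. The tree as a caterpillar
--
-- ku and kv index a short leg at u and at v.  The spine consists of the
-- other leg of u (A vertices, ending at u), the u–v path (p + 1 vertices)
-- and the other leg of v (B vertices, starting at v); it has coordinates
-- 0 … N with u at A and v at A + p.  The short legs ku, kv hang at u, v.

module Caterpillar (p : ℕ) (a b : Fin 2 → ℕ) (hp : 1 ≤ p) (ha : ∀ k → 1 ≤ a k) (hb : ∀ k → 1 ≤ b k)
         (ku kv : Fin 2) (hku : a ku ≡ 1) (hkv : b kv ≡ 1) where
  open TwoCoreTree p a b

  A B : ℕ
  A = a (op ku)
  B = b (op kv)

  A≥1 : 1 ≤ A
  A≥1 = ha (op ku)

  B≥1 : 1 ≤ B
  B≥1 = hb (op kv)

  -- The foot of a vertex: its spine coordinate, or that of the core it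
  -- hangs at.
  f : V → ℕ
  f (path i) = A + toℕ i
  f (uleg k j) with side ku k
  ... | short = A
  ... | spine = A ∸ suc (toℕ j)
  f (vleg k j) with side kv k
  ... | short = A + p
  ... | spine = suc (A + p + toℕ j)

  -- The offset of a vertex: its distance to its foot.
  o : V → ℕ
  o (path _) = 0
  o (uleg k _) with side ku k
  ... | short = 1
  ... | spine = 0
  o (vleg k _) with side kv k
  ... | short = 1
  ... | spine = 0

  -- The profile of x: its distance to the spine vertex with coordinate t.
  E : V → ℕ → ℕ
  E x t = o x + ∣ f x - t ∣

  -- The distance between distinct vertices (dist-formula below).
  d : V → V → ℕ
  d x y = o y + E x (f y)

  _≟V_ : DecidableEquality V
  path i ≟V path j with i ≟F j
  ... | yes refl = yes refl
  ... | no ne = no λ { refl → ne refl }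
  path _ ≟V uleg _ _ = no λ ()
  path _ ≟V vleg _ _ = no λ ()
  uleg _ _ ≟V path _ = no λ ()
  uleg k j ≟V uleg k' j' with k ≟F k'
  ... | no ne = no λ { refl → ne refl }
  ... | yes refl with j ≟F j'
  ...   | yes refl = yes refl
  ...   | no ne = no λ { refl → ne refl }
  uleg _ _ ≟V vleg _ _ = no λ ()
  vleg _ _ ≟V path _ = no λ ()
  vleg _ _ ≟V uleg _ _ = no λ ()
  vleg k j ≟V vleg k' j' with k ≟F k'
  ... | no ne = no λ { refl → ne refl }
  ... | yes refl with j ≟F j'
  ...   | yes refl = yes refl
  ...   | no ne = no λ { refl → ne refl }

  open Deletion Adj _≟V_ public

  adj-sym : ∀ {x y} → Adj x y → Adj y x
  adj-sym (inj₁ e) = inj₂ e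
  adj-sym (inj₂ e) = inj₁ e

  open WalkOps Adj adj-sym

  -- The formula d gives distance 1 along every edge (the short legs have
  -- no internal edges) ...
  edge-distance : ∀ {x y} → Edge x y → d x y ≡ 1
  edge-distance (e-path i) rewrite toℕ-inject₁ i | ∣m+n-m+o∣≡∣n-o∣ A (toℕ i) (suc (toℕ i)) = ∣n-sn∣ (toℕ i)
  edge-distance (e-u k j z) with side ku k
  ... | short rewrite +-identityʳ A | ∣n-n∣≡0 A = refl
  ... | spine rewrite z = ∣n+0-n∸1∣ A A≥1
  edge-distance (e-uu k j j' eq) with side ku k
  ... | short = ⊥-elim (lem (toℕ<n j'))
    where
    lem : toℕ j' < a ku → ⊥
    lem h rewrite hku | sym eq with h
    ... | s≤s ()
  ... | spine = subst (λ q → ∣ A ∸ suc (toℕ j) - A ∸ suc q ∣ ≡ 1) eq (∣∸∸∣ (toℕ j) A (subst (λ q → suc q ≤ A) (sym eq) (toℕ<n j')))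
  edge-distance (e-v k j z) with side kv k
  ... | short rewrite toℕ-fromℕ p | ∣n-n∣≡0 (A + p) = refl
  ... | spine rewrite toℕ-fromℕ p | z | +-identityʳ (A + p) = ∣n-sn∣ (A + p)
  edge-distance (e-vv k j j' eq) with side kv k
  ... | short = ⊥-elim (lem (toℕ<n j'))
    where
    lem : toℕ j' < b kv → ⊥
    lem h rewrite hkv | sym eq with h
    ... | s≤s ()
  ... | spine rewrite sym eq = trans (∣m+n-m+o∣≡∣n-o∣ (A + p) (toℕ j) (suc (toℕ j))) (∣n-sn∣ (toℕ j))

  distance-sym : ∀ x y → d x y ≡ d y x
  distance-sym x y rewrite ∣-∣-comm (f x) (f y) = swap+ (o y) (o x) _

  adj-distance : ∀ {x y} → Adj x y → d x y ≡ 1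
  adj-distance (inj₁ e) = edge-distance e
  adj-distance {x} {y} (inj₂ e) = trans (distance-sym x y) (edge-distance e)

  -- ... hence changes by at most 1 along an edge (triangle inequality) ...
  distance-step : ∀ {x y} z → Adj x y → d x z ≤ suc (d y z)
  distance-step {x} {y} z e = begin
      o z + (o x + ∣ f x - f z ∣)
    ≤⟨ +-monoʳ-≤ (o z) (+-monoʳ-≤ (o x) (∣-∣-triangle (f x) (f y) (f z))) ⟩
      o z + (o x + (∣ f x - f y ∣ + ∣ f y - f z ∣))
    ≡⟨ cong (o z +_) (sym (+-assoc (o x) _ _)) ⟩
      o z + ((o x + ∣ f x - f y ∣) + ∣ f y - f z ∣)
    ≤⟨ +-monoʳ-≤ (o z) (+-monoˡ-≤ (∣ f y - f z ∣) (≤-trans (m≤n+m _ (o y)) (≤-reflexive (adj-distance e)))) ⟩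
      o z + suc ∣ f y - f z ∣
    ≤⟨ +-monoʳ-≤ (o z) (s≤s (m≤n+m _ (o y))) ⟩
      o z + suc (o y + ∣ f y - f z ∣)
    ≡⟨ +-suc (o z) _ ⟩
      suc (o z + (o y + ∣ f y - f z ∣))
    ∎
    where open ≤-Reasoning

  -- ... and so bounds the length of every walk between distinct vertices.
  walk-bound : ∀ {x z m} → Walk x z m → x ≢ z → d x z ≤ m
  walk-bound here ne = ⊥-elim (ne refl)
  walk-bound {z = z} (step {y = y} e w) ne with y ≟V z
  ... | yes refl = ≤-trans (≤-reflexive (adj-distance e)) (s≤s z≤n)
  ... | no ne' = ≤-trans (distance-step z e) (s≤s (walk-bound w ne'))

  N : ℕ
  N = A + p + B

  spineAt : ℕ → V
  spineAt n with n <? A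
  ... | yes h = uleg (op ku) (fromℕ< (∸-lt A n h))
  ... | no _ with n ∸ A <? suc p
  ...   | yes h = path (fromℕ< h)
  ...   | no _ with n ∸ A ∸ suc p <? B
  ...     | yes h = vleg (op kv) (fromℕ< h)
  ...     | no _ = path fzero

  spine-at-uleg : ∀ n (j : Fin A) → suc n + toℕ j ≡ A → spineAt n ≡ uleg (op ku) j
  spine-at-uleg n j eq with n <? A
  ... | yes h = cong (uleg (op ku)) (toℕ-injective (trans (toℕ-fromℕ< (∸-lt A n h)) (∸-of-sum A n (toℕ j) eq)))
  ... | no nh = ⊥-elim (nh (≤-trans (s≤s (m≤m+n n (toℕ j))) (≤-reflexive eq)))

  spine-at-path : ∀ (i : Fin (suc p)) → spineAt (A + toℕ i) ≡ path i
  spine-at-path i with A + toℕ i <? A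
  ... | yes h = ⊥-elim (m+n≮m A (toℕ i) h)
  ... | no _ with A + toℕ i ∸ A <? suc p
  ...   | yes h = cong path (toℕ-injective (trans (toℕ-fromℕ< h) (m+n∸m≡n A (toℕ i))))
  ...   | no nh = ⊥-elim (nh (subst (_< suc p) (sym (m+n∸m≡n A (toℕ i))) (toℕ<n i)))

  spine-at-path' : ∀ n (i : Fin (suc p)) → A + toℕ i ≡ n → spineAt n ≡ path i
  spine-at-path' _ i refl = spine-at-path i

  shift-beyond-v : ∀ t → suc (A + p + t) ∸ A ≡ suc p + t
  shift-beyond-v t = trans (cong (_∸ A) (assoc-suc A p t)) (m+n∸m≡n A _)

  index-beyond-v : ∀ t → suc (A + p + t) ∸ A ∸ suc p ≡ t
  index-beyond-v t = trans (cong (_∸ suc p) (shift-beyond-v t)) (m+n∸m≡n (suc p) t)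

  spine-at-vleg : ∀ (j : Fin B) → spineAt (suc (A + p + toℕ j)) ≡ vleg (op kv) j
  spine-at-vleg j with suc (A + p + toℕ j) <? A
  ... | yes h = ⊥-elim (m+n≮m A (suc (p + toℕ j)) (subst (_< A) (assoc-suc A p (toℕ j)) h))
  ... | no _ with suc (A + p + toℕ j) ∸ A <? suc p
  ...   | yes h = ⊥-elim (m+n≮m (suc p) (toℕ j) (subst (_< suc p) (shift-beyond-v (toℕ j)) h))
  ...   | no _ with suc (A + p + toℕ j) ∸ A ∸ suc p <? B
  ...     | yes h = cong (vleg (op kv)) (toℕ-injective (trans (toℕ-fromℕ< h) (index-beyond-v (toℕ j))))
  ...     | no nh = ⊥-elim (nh (subst (_< B) (sym (index-beyond-v (toℕ j))) (toℕ<n j)))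

  offset01 : ∀ x → o x ≡ 0 ⊎ o x ≡ 1
  offset01 (path _) = inj₁ refl
  offset01 (uleg k _) with side ku k
  ... | short = inj₂ refl
  ... | spine = inj₁ refl
  offset01 (vleg k _) with side kv k
  ... | short = inj₂ refl
  ... | spine = inj₁ refl

  offset0-on-spine : ∀ x → o x ≡ 0 → spineAt (f x) ≡ x
  offset0-on-spine (path i) _ = spine-at-path i
  offset0-on-spine (uleg k j) h with side ku k
  offset0-on-spine (uleg k j) () | short
  ... | spine = spine-at-uleg (A ∸ suc (toℕ j)) j (suc-∸-+ A (toℕ j) (toℕ<n j))
  offset0-on-spine (vleg k j) h with side kv k
  offset0-on-spine (vleg k j) () | short
  ... | spine = spine-at-vleg j

  spine-A : spineAt A ≡ u
  spine-A = spine-at-path' A fzero (+-identityʳ A)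

  spine-Ap : spineAt (A + p) ≡ v
  spine-Ap = spine-at-path' (A + p) (fromℕ p) (cong (A +_) (toℕ-fromℕ p))

  offset1-hangs : ∀ x → o x ≡ 1 → Adj x (spineAt (f x))
  offset1-hangs (path i) ()
  offset1-hangs (uleg k j) h with side ku k
  ... | short = subst (Adj (uleg ku j)) (sym spine-A) (inj₂ (e-u ku j (index-of-short j hku)))
  offset1-hangs (uleg k j) () | spine
  offset1-hangs (vleg k j) h with side kv k
  ... | short = subst (Adj (vleg kv j)) (sym spine-Ap) (inj₂ (e-v kv j (index-of-short j hkv)))
  offset1-hangs (vleg k j) () | spine

  spine-view : ∀ n → (Σ ℕ λ r → suc n + r ≡ A) ⊎ (Σ ℕ λ i → A + i ≡ n × i ≤ p) ⊎ (Σ ℕ λ t → suc (A + p + t) ≡ n)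
  spine-view n with n <? A
  ... | yes h = inj₁ (A ∸ suc n , m+[n∸m]≡n h)
  ... | no nh with n ∸ A ≤? p
  ...   | yes h = inj₂ (inj₁ (n ∸ A , m+[n∸m]≡n (≮⇒≥ nh) , h))
  ...   | no nh2 = inj₂ (inj₂ (n ∸ A ∸ suc p , trans (assoc-suc A p _) (trans (cong (A +_) (m+[n∸m]≡n (≰⇒> nh2))) (m+[n∸m]≡n (≮⇒≥ nh)))))

  spine-adjacent : ∀ n → suc n ≤ N → Adj (spineAt n) (spineAt (suc n))
  spine-adjacent n le with spine-view n
  ... | inj₁ (suc r , eq) = subst₂ Adj (sym e1) (sym e2) (inj₂ (e-uu (op ku) j' j (trans (cong suc (toℕ-fromℕ< r<A)) (sym (toℕ-fromℕ< sr<A)))))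
    where
    sr<A : suc r < A
    sr<A = ≤-trans (s≤s (s≤s (m≤n+m r n))) (≤-reflexive (trans (cong suc (sym (+-suc n r))) eq))
    r<A : r < A
    r<A = ≤-trans (n≤1+n _) sr<A
    j j' : Fin A
    j = fromℕ< sr<A
    j' = fromℕ< r<A
    e1 : spineAt n ≡ uleg (op ku) j
    e1 = spine-at-uleg n j (trans (cong (suc n +_) (toℕ-fromℕ< sr<A)) eq)
    e2 : spineAt (suc n) ≡ uleg (op ku) j'
    e2 = spine-at-uleg (suc n) j' (trans (cong (suc (suc n) +_) (toℕ-fromℕ< r<A)) (trans (cong suc (sym (+-suc n r))) eq))
  ... | inj₁ (zero , eq) = subst₂ Adj (sym e1) (sym e2) (inj₂ (e-u (op ku) j0 (toℕ-fromℕ< A≥1)))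
    where
    j0 : Fin A
    j0 = fromℕ< A≥1
    e1 : spineAt n ≡ uleg (op ku) j0
    e1 = spine-at-uleg n j0 (trans (cong (suc n +_) (toℕ-fromℕ< A≥1)) eq)
    e2 : spineAt (suc n) ≡ u
    e2 = spine-at-path' (suc n) fzero (trans (+-identityʳ A) (trans (sym eq) (+-identityʳ (suc n))))
  ... | inj₂ (inj₁ (i , refl , ip)) with m≤n⇒m<n∨m≡n ip
  ...   | inj₁ i<p = subst₂ Adj (sym e1) (sym e2) (inj₁ (e-path (fromℕ< i<p)))
    where
    e1 : spineAt (A + i) ≡ path (inject₁ (fromℕ< i<p))
    e1 = spine-at-path' (A + i) _ (cong (A +_) (trans (toℕ-inject₁ _) (toℕ-fromℕ< i<p)))
    e2 : spineAt (suc (A + i)) ≡ path (fsuc (fromℕ< i<p))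
    e2 = spine-at-path' (suc (A + i)) _ (trans (cong (λ q → A + suc q) (toℕ-fromℕ< i<p)) (+-suc A i))
  ...   | inj₂ refl = subst₂ Adj (sym e1) (sym e2) (inj₁ (e-v (op kv) j0 (toℕ-fromℕ< B≥1)))
    where
    j0 : Fin B
    j0 = fromℕ< B≥1
    e1 : spineAt (A + p) ≡ v
    e1 = spine-Ap
    e2 : spineAt (suc (A + p)) ≡ vleg (op kv) j0
    e2 = trans (cong (λ q → spineAt (suc q)) (sym (trans (cong (A + p +_) (toℕ-fromℕ< B≥1)) (+-identityʳ (A + p))))) (spine-at-vleg j0)
  spine-adjacent n le | inj₂ (inj₂ (t , refl)) = subst₂ Adj (sym e1) (sym e2) (inj₁ (e-vv (op kv) jt jt' (trans (cong suc (toℕ-fromℕ< t<B)) (sym (toℕ-fromℕ< st<B)))))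
    where
    st<B : suc t < B
    st<B = +-cancelˡ-≤ (A + p) _ _ (subst (_≤ N) (trans (cong suc (sym (+-suc (A + p) t))) (sym (+-suc (A + p) (suc t)))) le)
    t<B : t < B
    t<B = ≤-trans (n≤1+n _) st<B
    jt jt' : Fin B
    jt = fromℕ< t<B
    jt' = fromℕ< st<B
    e1 : spineAt (suc (A + p + t)) ≡ vleg (op kv) jt
    e1 = subst (λ q → spineAt (suc (A + p + q)) ≡ vleg (op kv) jt) (toℕ-fromℕ< t<B) (spine-at-vleg jt)
    e2 : spineAt (suc (suc (A + p + t))) ≡ vleg (op kv) jt'
    e2 = subst (λ q → spineAt q ≡ vleg (op kv) jt') (trans (cong (λ q → suc (A + p + q)) (toℕ-fromℕ< st<B)) (cong suc (+-suc (A + p) t))) (spine-at-vleg jt')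

  spine-walk : ∀ n k → n + k ≤ N → Walk (spineAt n) (spineAt (n + k)) k
  spine-walk n zero _ = subst (λ q → Walk (spineAt n) (spineAt q) 0) (sym (+-identityʳ n)) here
  spine-walk n (suc k) le = step (spine-adjacent n (≤-trans (s≤s (m≤m+n n k)) le'))
      (subst (λ q → Walk (spineAt (suc n)) (spineAt q) k) (sym (+-suc n k)) (spine-walk (suc n) k le'))
    where
    le' : suc n + k ≤ N
    le' = subst (_≤ N) (+-suc n k) le

  spine-walk-between : ∀ m n → m ≤ N → n ≤ N → Walk (spineAt m) (spineAt n) ∣ m - n ∣
  spine-walk-between m n hm hn with ≤-total m n
  ... | inj₁ m≤n = subst₂ (λ q r → Walk (spineAt m) (spineAt q) r) (m+[n∸m]≡n m≤n) (sym (m≤n⇒∣m-n∣≡n∸m m≤n))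
                     (spine-walk m (n ∸ m) (subst (_≤ N) (sym (m+[n∸m]≡n m≤n)) hn))
  ... | inj₂ n≤m = subst₂ (λ q r → Walk (spineAt q) (spineAt n) r) (m+[n∸m]≡n n≤m) (sym (m≤n⇒∣n-m∣≡n∸m n≤m))
                     (reverse (spine-walk n (m ∸ n) (subst (_≤ N) (sym (m+[n∸m]≡n n≤m)) hm)))

  A≤N : A ≤ N
  A≤N = ≤-trans (m≤m+n A p) (m≤m+n (A + p) B)

  foot≤N : ∀ x → f x ≤ N
  foot≤N (path i) = ≤-trans (+-monoʳ-≤ A (≤-pred (toℕ<n i))) (m≤m+n (A + p) B)
  foot≤N (uleg k j) with side ku k
  ... | short = A≤N
  ... | spine = ≤-trans (m∸n≤m A (suc (toℕ j))) A≤N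
  foot≤N (vleg k j) with side kv k
  ... | short = m≤m+n (A + p) B
  ... | spine = subst (_≤ N) (+-suc (A + p) (toℕ j)) (+-monoʳ-≤ (A + p) (toℕ<n j))

  walk-to-spine : ∀ x → Walk x (spineAt (f x)) (o x)
  walk-to-spine x with offset01 x
  ... | inj₁ h = subst₂ (Walk x) (sym (offset0-on-spine x h)) (sym h) here
  ... | inj₂ h = subst (Walk x (spineAt (f x))) (sym h) (step (offset1-hangs x h) here)

  walk-of-length-d : ∀ x y → Walk x y (d x y)
  walk-of-length-d x y = subst (Walk x y) eq (walk-to-spine x ++w (spine-walk-between (f x) (f y) (foot≤N x) (foot≤N y) ++w reverse (walk-to-spine y)))
    where
    eq : o x + (∣ f x - f y ∣ + o y) ≡ o y + (o x + ∣ f x - f y ∣)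
    eq = trans (cong (o x +_) (+-comm _ (o y))) (swap+ (o x) (o y) _)

  dist-formula : ∀ {x y} → x ≢ y → Dist x y (d x y)
  dist-formula {x} {y} ne = walk-of-length-d x y , λ m w → walk-bound w ne

  dist-unique : ∀ {x y m} → Dist x y m → x ≢ y → m ≡ d x y
  dist-unique {x} {y} D ne = ≤-antisym (proj₂ D (d x y) (walk-of-length-d x y)) (walk-bound (proj₁ D) ne)

  separates-if : ∀ {τ x y} → x ≢ τ → y ≢ τ → E x (f τ) ≢ E y (f τ) → Separates τ x y
  separates-if {τ} {x} {y} nx ny ne = d x τ , d y τ , dist-formula nx , dist-formula ny , λ eq → ne (+-cancelˡ-≡ (o τ) _ _ eq)

  separates-only-if : ∀ {τ x y} → Separates τ x y → x ≢ τ → y ≢ τ → E x (f τ) ≢ E y (f τ)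
  separates-only-if {τ} {x} {y} (m , n , Dm , Dn , mn) nx ny eq =
    mn (trans (dist-unique Dm nx) (trans (cong (o τ +_) eq) (sym (dist-unique Dn ny))))

  -- 3. Coordinates of particular vertices

  headU : ∀ k → Fin (a k)
  headU k = fromℕ< (ha k)
  headV : ∀ k → Fin (b k)
  headV k = fromℕ< (hb k)

  headU-unique : ∀ k (j : Fin (a k)) → toℕ j ≡ 0 → j ≡ headU k
  headU-unique k j e = toℕ-injective (trans e (sym (toℕ-fromℕ< (ha k))))
  headV-unique : ∀ k (j : Fin (b k)) → toℕ j ≡ 0 → j ≡ headV k
  headV-unique k j e = toℕ-injective (trans e (sym (toℕ-fromℕ< (hb k))))

  pendU pendV : V
  pendU = uleg ku (headU ku)
  pendV = vleg kv (headV kv)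

  fu-ku : ∀ j → f (uleg ku j) ≡ A
  fu-ku j rewrite side-self ku = refl
  ou-ku : ∀ j → o (uleg ku j) ≡ 1
  ou-ku j rewrite side-self ku = refl
  fu-op : ∀ j → f (uleg (op ku) j) ≡ A ∸ suc (toℕ j)
  fu-op j rewrite side-op ku = refl
  ou-op : ∀ j → o (uleg (op ku) j) ≡ 0
  ou-op j rewrite side-op ku = refl
  fv-kv : ∀ j → f (vleg kv j) ≡ A + p
  fv-kv j rewrite side-self kv = refl
  ov-kv : ∀ j → o (vleg kv j) ≡ 1
  ov-kv j rewrite side-self kv = refl
  fv-op : ∀ j → f (vleg (op kv) j) ≡ suc (A + p + toℕ j)
  fv-op j rewrite side-op kv = refl
  ov-op : ∀ j → o (vleg (op kv) j) ≡ 0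
  ov-op j rewrite side-op kv = refl

  fu<A : ∀ j → f (uleg (op ku) j) < A
  fu<A j rewrite fu-op j = ∸-lt A (toℕ j) (toℕ<n j)

  fv>Ap : ∀ j → A + p < f (vleg (op kv) j)
  fv>Ap j rewrite fv-op j = s≤s (m≤m+n (A + p) (toℕ j))

  headSpineV headSpineU : V
  headSpineV = vleg (op kv) (headV (op kv))
  headSpineU = uleg (op ku) (headU (op ku))

  f-headSpineU : f headSpineU ≡ A ∸ 1
  f-headSpineU = trans (fu-op (headU (op ku))) (cong (λ q → A ∸ suc q) (toℕ-fromℕ< (ha (op ku))))
  o-headSpineU : o headSpineU ≡ 0
  o-headSpineU = ou-op (headU (op ku))
  f-headSpineV : f headSpineV ≡ suc (A + p)
  f-headSpineV = trans (fv-op (headV (op kv)))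
                   (trans (cong (λ q → suc (A + p + q)) (toℕ-fromℕ< (hb (op kv)))) (cong suc (+-identityʳ (A + p))))
  o-headSpineV : o headSpineV ≡ 0
  o-headSpineV = ov-op (headV (op kv))

  offset≤1 : ∀ x → o x ≤ 1
  offset≤1 x with offset01 x
  ... | inj₁ e = ≤-trans (≤-reflexive e) z≤n
  ... | inj₂ e = ≤-reflexive e

  A≢Ap : A ≢ A + p
  A≢Ap e = <-irrefl e (m<m+n A hp)

  offset1-pendant : ∀ x → o x ≡ 1 → (x ≡ pendU × f x ≡ A) ⊎ (x ≡ pendV × f x ≡ A + p)
  offset1-pendant (path i) ()
  offset1-pendant (uleg k j) h with side ku k
  ... | short = inj₁ (cong (uleg ku) (headU-unique ku j (index-of-short j hku)) , refl)
  offset1-pendant (uleg k j) () | spine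
  offset1-pendant (vleg k j) h with side kv k
  ... | short = inj₂ (cong (vleg kv) (headV-unique kv j (index-of-short j hkv)) , refl)
  offset1-pendant (vleg k j) () | spine

  coords-injective : ∀ x y → f x ≡ f y → o x ≡ o y → x ≡ y
  coords-injective x y ef eo with offset01 x
  ... | inj₁ h = trans (sym (offset0-on-spine x h)) (trans (cong spineAt ef) (offset0-on-spine y (trans (sym eo) h)))
  ... | inj₂ h with offset1-pendant x h | offset1-pendant y (trans (sym eo) h)
  ...   | inj₁ (ex , _) | inj₁ (ey , _) = trans ex (sym ey)
  ...   | inj₁ (_ , fx) | inj₂ (_ , fy) = ⊥-elim (A≢Ap (trans (sym fx) (trans ef fy)))
  ...   | inj₂ (_ , fx) | inj₁ (_ , fy) = ⊥-elim (A≢Ap (trans (sym fy) (trans (sym ef) fx)))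
  ...   | inj₂ (ex , _) | inj₂ (ey , _) = trans ex (sym ey)

  same-foot : ∀ x y → x ≢ y → f x ≡ f y → f x ≡ A ⊎ f x ≡ A + p
  same-foot x y ne ef with offset01 x | offset01 y
  ... | inj₁ h | inj₁ h' = ⊥-elim (ne (coords-injective x y ef (trans h (sym h'))))
  ... | inj₂ h | inj₂ h' = ⊥-elim (ne (coords-injective x y ef (trans h (sym h'))))
  ... | inj₂ h | _ with offset1-pendant x h
  ...   | inj₁ (_ , e) = inj₁ e
  ...   | inj₂ (_ , e) = inj₂ e
  same-foot x y ne ef | inj₁ _ | inj₂ h' with offset1-pendant y h'
  ...   | inj₁ (_ , e) = inj₁ (trans ef e)
  ...   | inj₂ (_ , e) = inj₂ (trans ef e)

  below-u-on-uleg : ∀ τ → f τ < A → Σ (Fin A) λ j → τ ≡ uleg (op ku) j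
  below-u-on-uleg (path i) h = ⊥-elim (m+n≮m A (toℕ i) h)
  below-u-on-uleg (uleg k j) h with side ku k
  ... | short = ⊥-elim (n≮n A h)
  ... | spine = j , refl
  below-u-on-uleg (vleg k j) h with side kv k
  ... | short = ⊥-elim (m+n≮m A p h)
  ... | spine = ⊥-elim (m+n≮m A (suc (p + toℕ j)) (subst (_< A) (assoc-suc A p (toℕ j)) h))

  beyond-v-on-vleg : ∀ τ → A + p < f τ → Σ (Fin B) λ j → τ ≡ vleg (op kv) j
  beyond-v-on-vleg (path i) h = ⊥-elim (<⇒≱ h (+-monoʳ-≤ A (≤-pred (toℕ<n i))))
  beyond-v-on-vleg (uleg k j) h with side ku k
  ... | short = ⊥-elim (<⇒≱ h (m≤m+n A p))
  ... | spine = ⊥-elim (<⇒≱ h (≤-trans (m∸n≤m A (suc (toℕ j))) (m≤m+n A p)))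
  beyond-v-on-vleg (vleg k j) h with side kv k
  ... | short = ⊥-elim (n≮n (A + p) h)
  ... | spine = j , refl

  inModV⇒f< : ∀ τ → InModV τ → f τ < A + p
  inModV⇒f< (path i) h = +-monoʳ-< A h
  inModV⇒f< (uleg k j) _ with side ku k
  ... | short = m<m+n A hp
  ... | spine = ≤-<-trans (m∸n≤m A (suc (toℕ j))) (m<m+n A hp)

  f<⇒inModV : ∀ τ → f τ < A + p → InModV τ
  f<⇒inModV (path i) h = +-cancelˡ-< A _ _ h
  f<⇒inModV (uleg k j) h = tt
  f<⇒inModV (vleg k j) h with side kv k
  ... | short = ⊥-elim (n≮n (A + p) h)
  ... | spine = ⊥-elim (<-asym h (s≤s (m≤m+n (A + p) (toℕ j))))

  inModU⇒f> : ∀ τ → InModU τ → A < f τ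
  inModU⇒f> (path i) h = subst (_< A + toℕ i) (+-identityʳ A) (+-monoʳ-< A h)
  inModU⇒f> (vleg k j) _ with side kv k
  ... | short = m<m+n A hp
  ... | spine = s≤s (≤-trans (m≤m+n A p) (m≤m+n (A + p) (toℕ j)))

  f>⇒inModU : ∀ τ → A < f τ → InModU τ
  f>⇒inModU (path i) h = +-cancelˡ-< A 0 _ (subst (_< A + toℕ i) (sym (+-identityʳ A)) h)
  f>⇒inModU (uleg k j) h with side ku k
  ... | short = ⊥-elim (n≮n A h)
  ... | spine = ⊥-elim (<⇒≱ h (m∸n≤m A (suc (toℕ j))))
  f>⇒inModU (vleg k j) h = tt

  path-inj : ∀ {i i'} → path i ≡ path i' → i ≡ i'
  path-inj refl = refl
  uleg-k : ∀ {k k' j j'} → uleg k j ≡ uleg k' j' → k ≡ k'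
  uleg-k refl = refl
  vleg-k : ∀ {k k' j j'} → vleg k j ≡ vleg k' j' → k ≡ k'
  vleg-k refl = refl
  vleg-j : ∀ {k j j'} → vleg k j ≡ vleg k j' → j ≡ j'
  vleg-j refl = refl
  uleg-j : ∀ {k j j'} → uleg k j ≡ uleg k j' → j ≡ j'
  uleg-j refl = refl

  f≢⇒≢ : ∀ {x y} → f x ≢ f y → x ≢ y
  f≢⇒≢ h refl = h refl

  -- 4. Profiles and separation

  Agrees : V → V → V → Set
  Agrees x y τ = E x (f τ) ≡ E y (f τ)

  -- The exceptional pairs of profiles-agree-once.
  HangingNbrs : V → V → Set
  HangingNbrs x y = o x ≢ o y × (suc (f x) ≡ f y ⊎ suc (f y) ≡ f x)

  hanging? : ∀ x y → Dec (HangingNbrs x y)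
  hanging? x y = ¬? (o x ≟ o y) ×-dec ((suc (f x) ≟ f y) ⊎-dec (suc (f y) ≟ f x))

  agree-at-one-foot : ∀ {x y} τ τ' → x ≢ y → ¬ HangingNbrs x y → Agrees x y τ → Agrees x y τ' → f τ ≡ f τ'
  agree-at-one-foot {x} {y} τ τ' ne nh z z' with profiles-agree-once (f x) (f y) (o x) (o y) (f τ) (f τ') (offset≤1 x) (offset≤1 y) (λ { (ef , eo) → ne (coords-injective x y ef eo) }) z z'
  ... | inj₁ e = e
  ... | inj₂ h = ⊥-elim (nh h)

  separates-sym : ∀ {τ x y} → Separates τ x y → Separates τ y x
  separates-sym (m , n , Dm , Dn , ne) = n , m , Dn , Dm , λ e → ne (sym e)

  Ex : ∀ x F → o x ≡ 1 → f x ≡ F → ∀ t → E x t ≡ suc ∣ F - t ∣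
  Ex x F ox fx t rewrite ox | fx = refl
  Ey : ∀ y F → o y ≡ 0 → f y ≡ F → ∀ t → E y t ≡ ∣ F - t ∣
  Ey y F oy fy t rewrite oy | fy = refl

  separator-right-of : ∀ {x y τ F} → (∀ t → E x t ≡ suc ∣ F - t ∣) → (∀ t → E y t ≡ ∣ suc F - t ∣) → E x (f τ) ≢ E y (f τ) → F < f τ
  separator-right-of {τ = τ} {F} ex ey ne with F <? f τ
  ... | yes h = h
  ... | no h = ⊥-elim (ne (trans (ex _) (trans (eq-up F (f τ) (≮⇒≥ h)) (sym (ey _)))))

  separator-left-of : ∀ {x y τ F} → (∀ t → E x t ≡ suc ∣ suc F - t ∣) → (∀ t → E y t ≡ ∣ F - t ∣) → E x (f τ) ≢ E y (f τ) → f τ ≤ F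
  separator-left-of {τ = τ} {F} ex ey ne with f τ ≤? F
  ... | yes h = h
  ... | no h = ⊥-elim (ne (trans (ex _) (trans (eq-down F (f τ) (≰⇒> h)) (sym (ey _)))))

  separated-right-of : ∀ {x y τ F} → (∀ t → E x t ≡ suc ∣ F - t ∣) → (∀ t → E y t ≡ ∣ suc F - t ∣) → F < f τ → E x (f τ) ≢ E y (f τ)
  separated-right-of {τ = τ} {F} ex ey h e = ne-up F (f τ) h (trans (sym (ex _)) (trans e (ey _)))

  separated-left-of : ∀ {x y τ F} → (∀ t → E x t ≡ suc ∣ suc F - t ∣) → (∀ t → E y t ≡ ∣ F - t ∣) → f τ ≤ F → E x (f τ) ≢ E y (f τ)
  separated-left-of {τ = τ} {F} ex ey h e = ne-down F (f τ) h (trans (sym (ex _)) (trans e (ey _)))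

  E-vleg-kv : ∀ j t → E (vleg kv j) t ≡ suc ∣ A + p - t ∣
  E-vleg-kv j t rewrite ov-kv j | fv-kv j = refl
  E-headSpineV : ∀ t → E headSpineV t ≡ ∣ suc (A + p) - t ∣
  E-headSpineV t rewrite ov-op (headV (op kv)) | fv-op (headV (op kv)) | toℕ-fromℕ< (hb (op kv)) | +-identityʳ (A + p) = refl
  suc-A∸1 : suc (A ∸ 1) ≡ A
  suc-A∸1 = m+[n∸m]≡n A≥1
  E-uleg-ku : ∀ j t → E (uleg ku j) t ≡ suc ∣ suc (A ∸ 1) - t ∣
  E-uleg-ku j t rewrite ou-ku j | fu-ku j | suc-A∸1 = refl
  E-uleg-ku' : ∀ j t → E (uleg ku j) t ≡ suc ∣ A - t ∣
  E-uleg-ku' j t rewrite ou-ku j | fu-ku j = refl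
  E-headSpineU : ∀ t → E headSpineU t ≡ ∣ A ∸ 1 - t ∣
  E-headSpineU t rewrite ou-op (headU (op ku)) | fu-op (headU (op ku)) | toℕ-fromℕ< (ha (op ku)) = refl

  nearV< : p ∸ 1 < suc p
  nearV< = s≤s (m∸n≤m p 1)
  nearV : V
  nearV = path (fromℕ< nearV<)
  F-nearV : ℕ
  F-nearV = A + (p ∸ 1)
  suc-F-nearV : suc F-nearV ≡ A + p
  suc-F-nearV = trans (sym (+-suc A (p ∸ 1))) (cong (A +_) (m+[n∸m]≡n hp))
  E-nearV : ∀ t → E nearV t ≡ ∣ F-nearV - t ∣
  E-nearV t rewrite toℕ-fromℕ< nearV< = refl
  E-pendV : ∀ t → E pendV t ≡ suc ∣ suc F-nearV - t ∣
  E-pendV t rewrite suc-F-nearV = E-vleg-kv (headV kv) t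

  nearU< : 1 < suc p
  nearU< = s≤s hp
  nearU : V
  nearU = path (fromℕ< nearU<)
  E-nearU : ∀ t → E nearU t ≡ ∣ suc A - t ∣
  E-nearU t rewrite toℕ-fromℕ< nearU< | +-comm A 1 = refl

  v-between-neighbours : E headSpineV (A + p) ≡ E nearV (A + p)
  v-between-neighbours = begin
    E headSpineV (A + p)        ≡⟨ E-headSpineV (A + p) ⟩
    ∣ suc (A + p) - A + p ∣     ≡⟨ ∣sn-n∣ (A + p) ⟩
    1                           ≡⟨ sym (∣n-sn∣ F-nearV) ⟩
    ∣ F-nearV - suc F-nearV ∣   ≡⟨ cong (λ q → ∣ F-nearV - q ∣) suc-F-nearV ⟩
    ∣ F-nearV - A + p ∣         ≡⟨ sym (E-nearV (A + p)) ⟩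
    E nearV (A + p)             ∎
    where open ≡-Reasoning

  u-between-neighbours : E headSpineU A ≡ E nearU A
  u-between-neighbours = begin
    E headSpineU A              ≡⟨ E-headSpineU A ⟩
    ∣ A ∸ 1 - A ∣               ≡⟨ cong (λ q → ∣ A ∸ 1 - q ∣) (sym suc-A∸1) ⟩
    ∣ A ∸ 1 - suc (A ∸ 1) ∣     ≡⟨ ∣n-sn∣ (A ∸ 1) ⟩
    1                           ≡⟨ sym (∣sn-n∣ A) ⟩
    ∣ suc A - A ∣               ≡⟨ sym (E-nearU A) ⟩
    E nearU A                   ∎
    where open ≡-Reasoning

  -- 5. Localisation of separators of special pairs

  separator-pendV-headSpineV : ∀ τ → pendV ≢ τ → headSpineV ≢ τ → Separates τ pendV headSpineV →
                               Σ (Fin B) λ j → τ ≡ vleg (op kv) j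
  separator-pendV-headSpineV τ nx ny s =
    beyond-v-on-vleg τ (separator-right-of {pendV} {headSpineV} {τ} (E-vleg-kv (headV kv)) E-headSpineV (separates-only-if s nx ny))

  separator-pendU-headSpineU : ∀ τ → pendU ≢ τ → headSpineU ≢ τ → Separates τ pendU headSpineU →
                               Σ (Fin A) λ j → τ ≡ uleg (op ku) j
  separator-pendU-headSpineU τ nx ny s =
    below-u-on-uleg τ (≤-<-trans (separator-left-of {pendU} {headSpineU} {τ} (E-uleg-ku (headU ku)) E-headSpineU (separates-only-if s nx ny))
                                 (subst (A ∸ 1 <_) suc-A∸1 ≤-refl))

  separator-of-v-heads : ∀ k k' → k ≢ k' → ∀ τ → vleg k (headV k) ≢ τ → vleg k' (headV k') ≢ τ →
    Separates τ (vleg k (headV k)) (vleg k' (headV k')) → Σ (Fin 2) λ k'' → Σ (Fin (b k'')) λ j → τ ≡ vleg k'' j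
  separator-of-v-heads k k' k≢k' τ nx ny s with which kv k | which kv k'
  ... | inj₁ refl | inj₁ refl = ⊥-elim (k≢k' refl)
  ... | inj₁ refl | inj₂ refl = op kv , separator-pendV-headSpineV τ nx ny s
  ... | inj₂ refl | inj₁ refl = op kv , separator-pendV-headSpineV τ ny nx (separates-sym s)
  ... | inj₂ refl | inj₂ refl = ⊥-elim (k≢k' refl)

  separator-of-u-heads : ∀ k k' → k ≢ k' → ∀ τ → uleg k (headU k) ≢ τ → uleg k' (headU k') ≢ τ →
    Separates τ (uleg k (headU k)) (uleg k' (headU k')) → Σ (Fin 2) λ k'' → Σ (Fin (a k'')) λ j → τ ≡ uleg k'' j
  separator-of-u-heads k k' k≢k' τ nx ny s with which ku k | which ku k'
  ... | inj₁ refl | inj₁ refl = ⊥-elim (k≢k' refl)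
  ... | inj₁ refl | inj₂ refl = op ku , separator-pendU-headSpineU τ nx ny s
  ... | inj₂ refl | inj₁ refl = op ku , separator-pendU-headSpineU τ ny nx (separates-sym s)
  ... | inj₂ refl | inj₂ refl = ⊥-elim (k≢k' refl)

  separator-of-v-head-and-nearV : ∀ k τ → vleg k (headV k) ≢ τ → nearV ≢ τ → Separates τ (vleg k (headV k)) nearV →
                                  InModV τ ⊎ Σ (Fin (b k)) λ j → τ ≡ vleg k j
  separator-of-v-head-and-nearV k τ nx ny s with which kv k
  ... | inj₁ refl = inj₁ (f<⇒inModV τ (≤-<-trans (separator-left-of {pendV} {nearV} {τ} {F-nearV} E-pendV E-nearV (separates-only-if s nx ny))
                                                  (subst (F-nearV <_) suc-F-nearV ≤-refl)))
  ... | inj₂ refl with <-cmp (f τ) (A + p)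
  ...   | tri< h _ _ = inj₁ (f<⇒inModV τ h)
  ...   | tri> _ _ h = inj₂ (beyond-v-on-vleg τ h)
  ...   | tri≈ _ h _ = ⊥-elim (separates-only-if s nx ny (subst (λ t → E headSpineV t ≡ E nearV t) (sym h) v-between-neighbours))

  separator-of-u-head-and-nearU : ∀ k τ → uleg k (headU k) ≢ τ → nearU ≢ τ → Separates τ (uleg k (headU k)) nearU →
                                  InModU τ ⊎ Σ (Fin (a k)) λ j → τ ≡ uleg k j
  separator-of-u-head-and-nearU k τ nx ny s with which ku k
  ... | inj₁ refl = inj₁ (f>⇒inModU τ (separator-right-of {pendU} {nearU} {τ} {A} (E-uleg-ku' (headU ku)) E-nearU (separates-only-if s nx ny)))
  ... | inj₂ refl with <-cmp (f τ) A
  ...   | tri< h _ _ = inj₂ (below-u-on-uleg τ h)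
  ...   | tri> _ _ h = inj₁ (f>⇒inModU τ h)
  ...   | tri≈ _ h _ = ⊥-elim (separates-only-if s nx ny (subst (λ t → E headSpineU t ≡ E nearU t) (sym h) u-between-neighbours))

  -- 6. Positions on the modified legs

  p+1≡1+p : p + 1 ≡ suc p
  p+1≡1+p = +-comm p 1

  posV-path : ∀ (i : Fin (suc p)) → posModV (path i) ≤ p
  posV-path i = m∸n≤m p (toℕ i)
  posU-path : ∀ (i : Fin (suc p)) → posModU (path i) ≤ p
  posU-path i = ≤-pred (toℕ<n i)

  posV≤ : ∀ (i : Fin (suc p)) → p ∸ toℕ i ≢ suc p
  posV≤ i e = 1+n≰n (subst (_≤ p) e (posV-path i))
  posU≤ : ∀ (i : Fin (suc p)) → toℕ i ≢ suc p
  posU≤ i e = 1+n≰n (subst (_≤ p) e (posU-path i))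

  posV-head : ∀ k → posModV (uleg k (headU k)) ≡ suc p
  posV-head k rewrite toℕ-fromℕ< (ha k) = p+1≡1+p
  posU-head : ∀ k → posModU (vleg k (headV k)) ≡ suc p
  posU-head k rewrite toℕ-fromℕ< (hb k) = p+1≡1+p

  posV-first : ∀ x → InModV x → posModV x ≡ suc p → Σ (Fin 2) λ k → x ≡ uleg k (headU k)
  posV-first (path i) _ e = ⊥-elim (posV≤ i e)
  posV-first (uleg k j) _ e = k , cong (uleg k) (headU-unique k j (suc-injective (+-cancelˡ-≡ p _ _ (trans e (sym p+1≡1+p)))))
  posU-first : ∀ x → InModU x → posModU x ≡ suc p → Σ (Fin 2) λ k → x ≡ vleg k (headV k)
  posU-first (path i) _ e = ⊥-elim (posU≤ i e)
  posU-first (vleg k j) _ e = k , cong (vleg k) (headV-unique k j (suc-injective (+-cancelˡ-≡ p _ _ (trans e (sym p+1≡1+p)))))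

  posV-beyond-head : ∀ k (j : Fin (a k)) → toℕ j ≢ 0 → suc (suc p) ≤ posModV (uleg k j)
  posV-beyond-head k j nz = subst (suc (suc p) ≤_) (sym (+-suc p (toℕ j))) (s≤s (subst (suc p ≤_) (+-comm (toℕ j) p) (+-monoˡ-≤ p (n≢0⇒n>0 nz))))
  posU-beyond-head : ∀ k (j : Fin (b k)) → toℕ j ≢ 0 → suc (suc p) ≤ posModU (vleg k j)
  posU-beyond-head k j nz = subst (suc (suc p) ≤_) (sym (+-suc p (toℕ j))) (s≤s (subst (suc p ≤_) (+-comm (toℕ j) p) (+-monoˡ-≤ p (n≢0⇒n>0 nz))))

  posV-uleg : ∀ k (r : Fin (a k)) → posModV (uleg k r) ≡ suc p ⊎ suc (suc p) ≤ posModV (uleg k r)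
  posV-uleg k r with toℕ r ≟ 0
  ... | yes z = inj₁ (trans (cong (λ q → posModV (uleg k q)) (headU-unique k r z)) (posV-head k))
  ... | no nz = inj₂ (posV-beyond-head k r nz)
  posU-vleg : ∀ k (r : Fin (b k)) → posModU (vleg k r) ≡ suc p ⊎ suc (suc p) ≤ posModU (vleg k r)
  posU-vleg k r with toℕ r ≟ 0
  ... | yes z = inj₁ (trans (cong (λ q → posModU (vleg k q)) (headV-unique k r z)) (posU-head k))
  ... | no nz = inj₂ (posU-beyond-head k r nz)

  vNotInV : ¬ InModV v
  vNotInV h = n≮n p (subst (_< p) (toℕ-fromℕ p) h)

  uNotInU : ¬ InModU u
  uNotInU ()

  p∸1<p : p ∸ 1 < p
  p∸1<p = ∸-lt p 0 hp

  -- 7. A landmark set contains a local set of v and one of u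
  --
  -- The local set is L itself minus the core; each of the conditions
  -- (1)–(5) is forced by a pair whose separators were localised in §5.

  open LandmarkFacts Adj

  long≢short : ∀ {len : Fin 2 → ℕ} {k k'} → len k ≡ 1 → 2 ≤ len k' → k ≢ k'
  long≢short {len} hk hk' refl = 1+n≰n (subst (2 ≤_) hk hk')

  module LandmarkToLocalV (L : Subset) (lm : Landmark L) where
    S : Subset
    S = delete v L

    S0 S2 S3 : Fin 2 → Set
    S0 k = StdLeg.TypeS0 S (vleg k)
    S2 k = StdLeg.TypeS2 S (vleg k)
    S3 k = StdLeg.TypeS3 S (vleg k)
    M1 M2 M3 : Set
    M1 = ModLeg.TypeM1 S InModV posModV p
    M2 = ModLeg.TypeM2 S InModV posModV p
    M3 = ModLeg.TypeM3 S InModV posModV p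

    inS : ∀ τ → τ ∈ L → InModV τ → τ ∈ S
    inS τ h i = delete-∈ v L τ (λ e → vNotInV (subst InModV e i)) h

    -- (1) Two legs of v missing L would leave their first vertices unseparated.
    one-empty-leg : ∀ k k' → S0 k → S0 k' → k ≡ k'
    one-empty-leg k k' z z' with k ≟F k'
    ... | yes e = e
    ... | no ne = ⊥-elim (some-separator lm (z (headV k)) (z' (headV k')) (λ e → ne (vleg-k e)) on-empty-leg)
      where
      on-empty-leg : ∀ τ → τ ∈ L → ¬ Separates τ (vleg k (headV k)) (vleg k' (headV k'))
      on-empty-leg τ hτ s with separator-of-v-heads k k' ne τ (∉≢∈ {L} (z (headV k)) hτ) (∉≢∈ {L} (z' (headV k')) hτ) s
      ... | k'' , j , refl with fin2 k k' k'' ne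
      ...   | inj₁ refl = true≢false (trans (sym hτ) (z j))
      ...   | inj₂ refl = true≢false (trans (sym hτ) (z' j))

    -- (2) The modified leg of v has an admissible type.  If L contains the
    -- first vertex of a leg of u, it is (m,1) or (m,3).
    mod-type-with-head : ∀ k → uleg k (headU k) ∈ L → M1 ⊎ M2 ⊎ M3
    mod-type-with-head k h with any? (λ (i : Fin (suc p)) → (toℕ i <? p) ×-dec (S (path i) Bool.≟ true))
                              | any? (λ k' → any? (λ j' → ¬? (uleg k' j' ≟V uleg k (headU k)) ×-dec (L (uleg k' j') Bool.≟ true)))
    ... | yes (i , lt , hi) | _ = inj₂ (inj₂ (uleg k (headU k) , path i , (λ ()) , tt , lt , h , hi , posV-head k))
    ... | no _ | yes (k' , j' , ne , hj) = inj₂ (inj₂ (uleg k (headU k) , uleg k' j' , (λ e → ne (sym e)) , tt , tt , h , hj , posV-head k))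
    ... | no np | no nu = inj₁ (uleg k (headU k) , tt , posV-head k , h , unique)
      where
      unique : ∀ y → InModV y → y ∈ S → y ≡ uleg k (headU k)
      unique (path i) lt hy = ⊥-elim (np (i , lt , hy))
      unique (uleg k' j') _ hy with uleg k' j' ≟V uleg k (headU k)
      ... | yes e = e
      ... | no ne = ⊥-elim (nu (k' , j' , ne , hy))

    -- (2) Otherwise the first vertices of u's legs are separated only on u's
    -- legs, by vertices of position ≥ p + 2: type (m,2).
    separator-on-u-legs : (∀ k → uleg k (headU k) ∉ L) → ∀ τ → τ ∈ L →
      Separates τ (uleg ku (headU ku)) (uleg (op ku) (headU (op ku))) → Σ (Fin 2) λ k → Σ (Fin (a k)) λ j → τ ≡ uleg k j
    separator-on-u-legs head∉ τ hτ s =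
      separator-of-u-heads ku (op ku) (λ e → op≢ ku (sym e)) τ (∉≢∈ {L} (head∉ ku) hτ) (∉≢∈ {L} (head∉ (op ku)) hτ) s

    mod-type-without-heads : (∀ k → uleg k (headU k) ∉ L) → M2
    mod-type-without-heads head∉
      with lm (uleg ku (headU ku)) (uleg (op ku) (headU (op ku))) (head∉ ku) (head∉ (op ku)) (λ e → op≢ ku (sym (uleg-k e)))
    ... | τ₁ , τ₂ , nτ , h1 , h2 , s1 , s2 with separator-on-u-legs head∉ τ₁ h1 s1 | separator-on-u-legs head∉ τ₂ h2 s2
    ...   | k1 , j1 , refl | k2 , j2 , refl =
            first∉ , uleg k1 j1 , uleg k2 j2 , nτ , tt , tt , posV-beyond-head k1 j1 (not-head k1 j1 h1) , posV-beyond-head k2 j2 (not-head k2 j2 h2) , h1 , h2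
      where
      not-head : ∀ k (j : Fin (a k)) → uleg k j ∈ L → toℕ j ≢ 0
      not-head k j hj z = true≢false (trans (sym (subst (λ q → L (uleg k q) ≡ true) (headU-unique k j z) hj)) (head∉ k))
      first∉ : ∀ y → InModV y → posModV y ≡ suc p → y ∉ S
      first∉ y iy py with posV-first y iy py
      ... | k , refl = head∉ k

    mod-type : M1 ⊎ M2 ⊎ M3
    mod-type with any? (λ k → L (uleg k (headU k)) Bool.≟ true)
    ... | yes (k , h) = mod-type-with-head k h
    ... | no nf = inj₂ (inj₁ (mod-type-without-heads (λ k → ¬∈⇒∉ (λ h → nf (k , h)))))

    -- (3) If a leg of v misses L, its first vertex and the path vertex next
    -- to v are separated only inside the modified leg, so it is not (m,1).
    empty-leg-excludes-m1 : ∀ k → S0 k → ¬ M1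
    empty-leg-excludes-m1 k z (x , _ , posx , _ , unique) =
      separators-not-unique lm (z (headV k)) nearV∉ (λ ()) x only-x
      where
      inNear : InModV nearV
      inNear = subst (_< p) (sym (toℕ-fromℕ< nearV<)) p∸1<p
      nearV∉ : nearV ∉ L
      nearV∉ = ¬∈⇒∉ (λ h → posV≤ (fromℕ< nearV<) (trans (cong posModV (unique nearV inNear (inS nearV h inNear))) posx))
      only-x : ∀ τ → τ ∈ L → Separates τ (vleg k (headV k)) nearV → τ ≡ x
      only-x τ hτ s with separator-of-v-head-and-nearV k τ (∉≢∈ {L} (z (headV k)) hτ) (∉≢∈ {L} nearV∉ hτ) s
      ... | inj₁ iτ = unique τ iτ (inS τ hτ iτ)
      ... | inj₂ (j , refl) = ⊥-elim (true≢false (trans (sym hτ) (z j)))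

    -- (4) holds vacuously: v has at most one long leg.
    two-long-legs : ∀ k → 2 ≤ b k → S0 k → ∀ k' → 2 ≤ b k' → k' ≢ k → S2 k'
    two-long-legs k hk _ k' hk' ne with fin2 k k' kv (λ e → ne (sym e))
    ... | inj₁ refl = ⊥-elim (long≢short {b} hkv hk refl)
    ... | inj₂ refl = ⊥-elim (long≢short {b} hkv hk' refl)

    -- (5) If the short leg misses L and the long leg had a single vertex of
    -- position ≥ 2, that vertex would be the only separator of the two first
    -- vertices.
    short-empty : ∀ k → b k ≡ 1 → S0 k → ∀ k' → 2 ≤ b k' → S2 k' ⊎ S3 k'
    short-empty k hk z k' hk' with classify S (vleg k')
    ... | inj₂ (inj₂ r) = r
    ... | inj₁ z' = ⊥-elim (long≢short {b} hk hk' (one-empty-leg k k' z z'))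
    ... | inj₂ (inj₁ (j , hj , two , unique)) =
          ⊥-elim (separators-not-unique lm (z (headV k)) head'∉ (λ e → kk (vleg-k e)) (vleg k' j) only-j)
      where
      kk : k ≢ k'
      kk = long≢short {b} hk hk'
      head'∉ : vleg k' (headV k') ∉ L
      head'∉ = ¬∈⇒∉ (λ hy → 1+n≰n (subst (λ q → 2 ≤ suc q) (trans (cong toℕ (sym (unique (headV k') hy))) (toℕ-fromℕ< (hb k'))) two))
      only-j : ∀ τ → τ ∈ L → Separates τ (vleg k (headV k)) (vleg k' (headV k')) → τ ≡ vleg k' j
      only-j τ hτ s with separator-of-v-heads k k' kk τ (∉≢∈ {L} (z (headV k)) hτ) (∉≢∈ {L} head'∉ hτ) s
      ... | k'' , j'' , refl with fin2 k k' k'' kk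
      ...   | inj₁ refl = ⊥-elim (true≢false (trans (sym hτ) (z j'')))
      ...   | inj₂ refl = cong (vleg k') (unique j'' hτ)

    local : IsLocal v b vleg InModV posModV p S
    local = delete-self v L , one-empty-leg , (λ k → classify S (vleg k)) , mod-type , empty-leg-excludes-m1 , two-long-legs , short-empty

  -- The same argument at u, with the roles of u and v exchanged.
  module LandmarkToLocalU (L : Subset) (lm : Landmark L) where
    S : Subset
    S = delete u L

    S0 S2 S3 : Fin 2 → Set
    S0 k = StdLeg.TypeS0 S (uleg k)
    S2 k = StdLeg.TypeS2 S (uleg k)
    S3 k = StdLeg.TypeS3 S (uleg k)
    M1 M2 M3 : Set
    M1 = ModLeg.TypeM1 S InModU posModU p
    M2 = ModLeg.TypeM2 S InModU posModU p
    M3 = ModLeg.TypeM3 S InModU posModU p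

    inS : ∀ τ → τ ∈ L → InModU τ → τ ∈ S
    inS τ h i = delete-∈ u L τ (λ e → uNotInU (subst InModU e i)) h

    one-empty-leg : ∀ k k' → S0 k → S0 k' → k ≡ k'
    one-empty-leg k k' z z' with k ≟F k'
    ... | yes e = e
    ... | no ne = ⊥-elim (some-separator lm (z (headU k)) (z' (headU k')) (λ e → ne (uleg-k e)) on-empty-leg)
      where
      on-empty-leg : ∀ τ → τ ∈ L → ¬ Separates τ (uleg k (headU k)) (uleg k' (headU k'))
      on-empty-leg τ hτ s with separator-of-u-heads k k' ne τ (∉≢∈ {L} (z (headU k)) hτ) (∉≢∈ {L} (z' (headU k')) hτ) s
      ... | k'' , j , refl with fin2 k k' k'' ne
      ...   | inj₁ refl = true≢false (trans (sym hτ) (z j))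
      ...   | inj₂ refl = true≢false (trans (sym hτ) (z' j))

    mod-type-with-head : ∀ k → vleg k (headV k) ∈ L → M1 ⊎ M2 ⊎ M3
    mod-type-with-head k h with any? (λ (i : Fin (suc p)) → (0 <? toℕ i) ×-dec (S (path i) Bool.≟ true))
                              | any? (λ k' → any? (λ j' → ¬? (vleg k' j' ≟V vleg k (headV k)) ×-dec (L (vleg k' j') Bool.≟ true)))
    ... | yes (i , lt , hi) | _ = inj₂ (inj₂ (vleg k (headV k) , path i , (λ ()) , tt , lt , h , hi , posU-head k))
    ... | no _ | yes (k' , j' , ne , hj) = inj₂ (inj₂ (vleg k (headV k) , vleg k' j' , (λ e → ne (sym e)) , tt , tt , h , hj , posU-head k))
    ... | no np | no nu = inj₁ (vleg k (headV k) , tt , posU-head k , h , unique)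
      where
      unique : ∀ y → InModU y → y ∈ S → y ≡ vleg k (headV k)
      unique (path i) lt hy = ⊥-elim (np (i , lt , hy))
      unique (vleg k' j') _ hy with vleg k' j' ≟V vleg k (headV k)
      ... | yes e = e
      ... | no ne = ⊥-elim (nu (k' , j' , ne , hy))

    separator-on-v-legs : (∀ k → vleg k (headV k) ∉ L) → ∀ τ → τ ∈ L →
      Separates τ (vleg kv (headV kv)) (vleg (op kv) (headV (op kv))) → Σ (Fin 2) λ k → Σ (Fin (b k)) λ j → τ ≡ vleg k j
    separator-on-v-legs head∉ τ hτ s =
      separator-of-v-heads kv (op kv) (λ e → op≢ kv (sym e)) τ (∉≢∈ {L} (head∉ kv) hτ) (∉≢∈ {L} (head∉ (op kv)) hτ) s

    mod-type-without-heads : (∀ k → vleg k (headV k) ∉ L) → M2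
    mod-type-without-heads head∉
      with lm (vleg kv (headV kv)) (vleg (op kv) (headV (op kv))) (head∉ kv) (head∉ (op kv)) (λ e → op≢ kv (sym (vleg-k e)))
    ... | τ₁ , τ₂ , nτ , h1 , h2 , s1 , s2 with separator-on-v-legs head∉ τ₁ h1 s1 | separator-on-v-legs head∉ τ₂ h2 s2
    ...   | k1 , j1 , refl | k2 , j2 , refl =
            first∉ , vleg k1 j1 , vleg k2 j2 , nτ , tt , tt , posU-beyond-head k1 j1 (not-head k1 j1 h1) , posU-beyond-head k2 j2 (not-head k2 j2 h2) , h1 , h2
      where
      not-head : ∀ k (j : Fin (b k)) → vleg k j ∈ L → toℕ j ≢ 0
      not-head k j hj z = true≢false (trans (sym (subst (λ q → L (vleg k q) ≡ true) (headV-unique k j z) hj)) (head∉ k))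
      first∉ : ∀ y → InModU y → posModU y ≡ suc p → y ∉ S
      first∉ y iy py with posU-first y iy py
      ... | k , refl = head∉ k

    mod-type : M1 ⊎ M2 ⊎ M3
    mod-type with any? (λ k → L (vleg k (headV k)) Bool.≟ true)
    ... | yes (k , h) = mod-type-with-head k h
    ... | no nf = inj₂ (inj₁ (mod-type-without-heads (λ k → ¬∈⇒∉ (λ h → nf (k , h)))))

    empty-leg-excludes-m1 : ∀ k → S0 k → ¬ M1
    empty-leg-excludes-m1 k z (x , _ , posx , _ , unique) =
      separators-not-unique lm (z (headU k)) nearU∉ (λ ()) x only-x
      where
      inNear : InModU nearU
      inNear = subst (0 <_) (sym (toℕ-fromℕ< nearU<)) (s≤s z≤n)
      nearU∉ : nearU ∉ L
      nearU∉ = ¬∈⇒∉ (λ h → posU≤ (fromℕ< nearU<) (trans (cong posModU (unique nearU inNear (inS nearU h inNear))) posx))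
      only-x : ∀ τ → τ ∈ L → Separates τ (uleg k (headU k)) nearU → τ ≡ x
      only-x τ hτ s with separator-of-u-head-and-nearU k τ (∉≢∈ {L} (z (headU k)) hτ) (∉≢∈ {L} nearU∉ hτ) s
      ... | inj₁ iτ = unique τ iτ (inS τ hτ iτ)
      ... | inj₂ (j , refl) = ⊥-elim (true≢false (trans (sym hτ) (z j)))

    two-long-legs : ∀ k → 2 ≤ a k → S0 k → ∀ k' → 2 ≤ a k' → k' ≢ k → S2 k'
    two-long-legs k hk _ k' hk' ne with fin2 k k' ku (λ e → ne (sym e))
    ... | inj₁ refl = ⊥-elim (long≢short {a} hku hk refl)
    ... | inj₂ refl = ⊥-elim (long≢short {a} hku hk' refl)

    short-empty : ∀ k → a k ≡ 1 → S0 k → ∀ k' → 2 ≤ a k' → S2 k' ⊎ S3 k'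
    short-empty k hk z k' hk' with classify S (uleg k')
    ... | inj₂ (inj₂ r) = r
    ... | inj₁ z' = ⊥-elim (long≢short {a} hk hk' (one-empty-leg k k' z z'))
    ... | inj₂ (inj₁ (j , hj , two , unique)) =
          ⊥-elim (separators-not-unique lm (z (headU k)) head'∉ (λ e → kk (uleg-k e)) (uleg k' j) only-j)
      where
      kk : k ≢ k'
      kk = long≢short {a} hk hk'
      head'∉ : uleg k' (headU k') ∉ L
      head'∉ = ¬∈⇒∉ (λ hy → 1+n≰n (subst (λ q → 2 ≤ suc q) (trans (cong toℕ (sym (unique (headU k') hy))) (toℕ-fromℕ< (ha k'))) two))
      only-j : ∀ τ → τ ∈ L → Separates τ (uleg k (headU k)) (uleg k' (headU k')) → τ ≡ uleg k' j
      only-j τ hτ s with separator-of-u-heads k k' kk τ (∉≢∈ {L} (z (headU k)) hτ) (∉≢∈ {L} head'∉ hτ) s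
      ... | k'' , j'' , refl with fin2 k k' k'' kk
      ...   | inj₁ refl = ⊥-elim (true≢false (trans (sym hτ) (z j'')))
      ...   | inj₂ refl = cong (uleg k') (unique j'' hτ)

    local : IsLocal u a uleg InModU posModU p S
    local = delete-self u L , one-empty-leg , (λ k → classify S (uleg k)) , mod-type , empty-leg-excludes-m1 , two-long-legs , short-empty

  -- 8. Local sets of v and of u give a landmark set
  --
  -- The local sets supply landmarks in prescribed regions of the spine.
  -- Two distinct non-landmarks x, y that are not hanging neighbours are
  -- separated by every vertex outside a single foot, which is A or A + p
  -- if two landmarks fail; both local sets give two landmarks off these
  -- feet.  Hanging neighbours are separated exactly by the vertices on one
  -- side of a foot, where conditions (1), (3) and (5) place two landmarks.

  open LocalSetFacts Adj

  TwoIn : Subset → (V → Set) → Set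
  TwoIn L P = Σ V λ α → Σ V λ β → α ≢ β × α ∈ L × β ∈ L × P α × P β

  two-in-map : ∀ {L P Q} → (∀ τ → P τ → Q τ) → TwoIn L P → TwoIn L Q
  two-in-map g (α , β , ne , hα , hβ , pα , pβ) = α , β , ne , hα , hβ , g α pα , g β pβ

  module LocalToLandmarkV (L S : Subset) (S⊆L : S ⊆ L) (loc : IsLocal v b vleg InModV posModV p S) where
    two-left-of-v : ¬ ModLeg.TypeM1 S InModV posModV p → TwoIn L (λ τ → f τ < A + p)
    two-left-of-v n with mod-meets-twice loc n
    ... | x , y , ne , ix , iy , hx , hy = x , y , ne , S⊆L x hx , S⊆L y hy , inModV⇒f< x ix , inModV⇒f< y iy

    two-off-v : TwoIn L (λ τ → f τ ≢ A + p)
    two-off-v with leg-meets loc (op kv)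
    ... | inj₁ z = two-in-map (λ τ h e → <-irrefl e h) (two-left-of-v (empty-excludes-m1 loc (op kv) z))
    ... | inj₂ (j , h) with mod-meets loc
    ...   | x , ix , hx = vleg (op kv) j , x , f≢⇒≢ (λ e → <-asym (fv>Ap j) (subst (_< A + p) (sym e) (inModV⇒f< x ix))) ,
                          S⊆L _ h , S⊆L x hx , (λ e → <-irrefl (sym e) (fv>Ap j)) , (λ e → <-irrefl e (inModV⇒f< x ix))

    head∉S : ∀ k (j : Fin (b k)) → toℕ j ≡ 0 → vleg k (headV k) ∉ L → vleg k j ∉ S
    head∉S k j z h = subst (λ q → S (vleg k q) ≡ false) (sym (headV-unique k j z)) (∉-⊆ S⊆L h)

    short-leg-empty : ∀ k → b k ≡ 1 → vleg k (headV k) ∉ L → StdLeg.TypeS0 S (vleg k)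
    short-leg-empty k hk h j = head∉S k j (index-of-short j hk) h

    -- Without the pendant vertex at v, two landmarks lie left of v (3) ...
    two-left-of-v-without-pendant : pendV ∉ L → TwoIn L (λ τ → f τ < A + p)
    two-left-of-v-without-pendant h = two-left-of-v (empty-excludes-m1 loc kv (short-leg-empty kv hkv h))

    -- ... and without the first spine vertex beyond v, two lie right of v (1, 5).
    two-right-of-v : pendV ∉ L → headSpineV ∉ L → TwoIn L (λ τ → A + p < f τ)
    two-right-of-v hl hw with m≤n⇒m<n∨m≡n (hb (op kv))
    ... | inj₂ e = ⊥-elim (op≢ kv (sym (one-empty loc kv (op kv) (short-leg-empty kv hkv hl) (short-leg-empty (op kv) (sym e) hw))))
    ... | inj₁ two with short-empty loc kv hkv (short-leg-empty kv hkv hl) (op kv) two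
    ...   | inj₁ (j , j' , ne , h , h') = vleg (op kv) j , vleg (op kv) j' , (λ e → ne (vleg-j e)) , S⊆L _ h , S⊆L _ h' , fv>Ap j , fv>Ap j'
    ...   | inj₂ (j , z , h , _) = ⊥-elim (true≢false (trans (sym h) (head∉S (op kv) j z hw)))

  module LocalToLandmarkU (L S : Subset) (S⊆L : S ⊆ L) (loc : IsLocal u a uleg InModU posModU p S) where
    two-right-of-u : ¬ ModLeg.TypeM1 S InModU posModU p → TwoIn L (λ τ → A < f τ)
    two-right-of-u n with mod-meets-twice loc n
    ... | x , y , ne , ix , iy , hx , hy = x , y , ne , S⊆L x hx , S⊆L y hy , inModU⇒f> x ix , inModU⇒f> y iy

    two-off-u : TwoIn L (λ τ → f τ ≢ A)
    two-off-u with leg-meets loc (op ku)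
    ... | inj₁ z = two-in-map (λ τ h e → <-irrefl (sym e) h) (two-right-of-u (empty-excludes-m1 loc (op ku) z))
    ... | inj₂ (j , h) with mod-meets loc
    ...   | x , ix , hx = uleg (op ku) j , x , f≢⇒≢ (λ e → <-asym (fu<A j) (subst (A <_) (sym e) (inModU⇒f> x ix))) ,
                          S⊆L _ h , S⊆L x hx , (λ e → <-irrefl e (fu<A j)) , (λ e → <-irrefl (sym e) (inModU⇒f> x ix))

    head∉S : ∀ k (j : Fin (a k)) → toℕ j ≡ 0 → uleg k (headU k) ∉ L → uleg k j ∉ S
    head∉S k j z h = subst (λ q → S (uleg k q) ≡ false) (sym (headU-unique k j z)) (∉-⊆ S⊆L h)

    short-leg-empty : ∀ k → a k ≡ 1 → uleg k (headU k) ∉ L → StdLeg.TypeS0 S (uleg k)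
    short-leg-empty k hk h j = head∉S k j (index-of-short j hk) h

    two-right-of-u-without-pendant : pendU ∉ L → TwoIn L (λ τ → A < f τ)
    two-right-of-u-without-pendant h = two-right-of-u (empty-excludes-m1 loc ku (short-leg-empty ku hku h))

    two-left-of-u : pendU ∉ L → headSpineU ∉ L → TwoIn L (λ τ → f τ < A)
    two-left-of-u hl hw with m≤n⇒m<n∨m≡n (ha (op ku))
    ... | inj₂ e = ⊥-elim (op≢ ku (sym (one-empty loc ku (op ku) (short-leg-empty ku hku hl) (short-leg-empty (op ku) (sym e) hw))))
    ... | inj₁ two with short-empty loc ku hku (short-leg-empty ku hku hl) (op ku) two
    ...   | inj₁ (j , j' , ne , h , h') = uleg (op ku) j , uleg (op ku) j' , (λ e → ne (uleg-j e)) , S⊆L _ h , S⊆L _ h' , fu<A j , fu<A j'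
    ...   | inj₂ (j , z , h , _) = ⊥-elim (true≢false (trans (sym h) (head∉S (op ku) j z hw)))

    three-landmarks : Σ V λ α → Σ V λ β → Σ V λ γ → α ≢ β × α ≢ γ × β ≢ γ × α ∈ L × β ∈ L × γ ∈ L
    three-landmarks with leg-meets loc (op ku) | leg-meets loc ku
    ... | inj₁ z | inj₁ z' = ⊥-elim (op≢ ku (sym (one-empty loc ku (op ku) z' z)))
    ... | inj₁ z | inj₂ (j , h) with two-right-of-u (empty-excludes-m1 loc (op ku) z)
    ...   | x , y , ne , hx , hy , fx , fy =
            uleg ku j , x , y , f≢⇒≢ (λ e → <-irrefl (trans (sym (fu-ku j)) e) fx) , f≢⇒≢ (λ e → <-irrefl (trans (sym (fu-ku j)) e) fy) ,
            ne , S⊆L _ h , hx , hy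
    three-landmarks | inj₂ (j , h) | inj₁ z' with two-right-of-u (empty-excludes-m1 loc ku z')
    ...   | x , y , ne , hx , hy , fx , fy =
            uleg (op ku) j , x , y , f≢⇒≢ (λ e → <-asym (fu<A j) (subst (A <_) (sym e) fx)) , f≢⇒≢ (λ e → <-asym (fu<A j) (subst (A <_) (sym e) fy)) ,
            ne , S⊆L _ h , hx , hy
    three-landmarks | inj₂ (j , h) | inj₂ (j' , h') with mod-meets loc
    ...   | x , ix , hx =
            uleg (op ku) j , uleg ku j' , x ,
            f≢⇒≢ (λ e → <-irrefl (trans e (fu-ku j')) (fu<A j)) ,
            f≢⇒≢ (λ e → <-asym (fu<A j) (subst (A <_) (sym e) (inModU⇒f> x ix))) ,
            f≢⇒≢ (λ e → <-irrefl (trans (sym (fu-ku j')) e) (inModU⇒f> x ix)) ,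
            S⊆L _ h , S⊆L _ h' , S⊆L x hx

  module LocalToLandmark (L Sv Su : Subset) (Sv⊆L : Sv ⊆ L) (locV : IsLocal v b vleg InModV posModV p Sv)
                         (Su⊆L : Su ⊆ L) (locU : IsLocal u a uleg InModU posModU p Su) where
    open LocalToLandmarkV L Sv Sv⊆L locV using (two-off-v; two-left-of-v-without-pendant; two-right-of-v)
    open LocalToLandmarkU L Su Su⊆L locU using (two-off-u; two-right-of-u-without-pendant; two-left-of-u; three-landmarks)

    Separating : V → V → V → Set
    Separating x y τ = ¬ Agrees x y τ

    -- A pendant vertex x and a spine vertex y one step from its foot are
    -- separated by the vertices on the side of y, beyond the foot of x.
    pendant-case : ∀ x y → x ∉ L → y ∉ L → o x ≡ 1 → o y ≡ 0 → (suc (f x) ≡ f y ⊎ suc (f y) ≡ f x) →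
                   TwoIn L (Separating x y)
    pendant-case x y hx hy ox oy adj with offset1-pendant x ox
    ... | inj₁ (refl , fx) with adj
    ...   | inj₁ e = two-in-map (λ τ → separated-right-of {x} {y} {τ} {A} (Ex x A ox fx) (Ey y (suc A) oy (trans (sym e) (cong suc fx))))
                       (two-right-of-u-without-pendant hx)
    ...   | inj₂ e = two-in-map (λ τ h → separated-left-of {x} {y} {τ} {f y} (Ex x (suc (f y)) ox (trans fx (sym e'))) (Ey y (f y) oy refl)
                                           (≤-pred (subst (f τ <_) (sym e') h)))
                       (two-left-of-u hx (subst (_∉ L) y≡head hy))
      where
      e' : suc (f y) ≡ A
      e' = trans e fx
      y≡head : y ≡ headSpineU
      y≡head = coords-injective y headSpineU (trans (cong pred e') (sym f-headSpineU)) (trans oy (sym o-headSpineU))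
    pendant-case x y hx hy ox oy adj | inj₂ (refl , fx) with adj
    ...   | inj₁ e = two-in-map (λ τ → separated-right-of {x} {y} {τ} {A + p} (Ex x (A + p) ox fx) (Ey y (suc (A + p)) oy e'))
                       (two-right-of-v hx (subst (_∉ L) y≡head hy))
      where
      e' : f y ≡ suc (A + p)
      e' = trans (sym e) (cong suc fx)
      y≡head : y ≡ headSpineV
      y≡head = coords-injective y headSpineV (trans e' (sym f-headSpineV)) (trans oy (sym o-headSpineV))
    ...   | inj₂ e = two-in-map (λ τ h → separated-left-of {x} {y} {τ} {f y} (Ex x (suc (f y)) ox (trans fx (sym e'))) (Ey y (f y) oy refl)
                                           (≤-pred (subst (f τ <_) (sym e') h)))
                       (two-left-of-v-without-pendant hx)
      where
      e' : suc (f y) ≡ A + p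
      e' = trans e fx

    hanging-case : ∀ x y → x ∉ L → y ∉ L → HangingNbrs x y → TwoIn L (Separating x y)
    hanging-case x y hx hy (o≢ , adj) with offset01 x | offset01 y
    ... | inj₂ ox | inj₁ oy = pendant-case x y hx hy ox oy adj
    ... | inj₁ ox | inj₂ oy = two-in-map (λ τ n z → n (sym z)) (pendant-case y x hy hx oy ox (⊎-swap adj))
    ... | inj₁ ox | inj₁ oy = ⊥-elim (o≢ (trans ox (sym oy)))
    ... | inj₂ ox | inj₂ oy = ⊥-elim (o≢ (trans ox (sym oy)))

    -- If two distinct vertices s, t fail to separate non-hanging x and y,
    -- every non-separator has their common foot, A or A + p; the two
    -- landmarks off that foot separate.
    from-two-non-separators : ∀ x y → x ≢ y → ¬ HangingNbrs x y → ∀ s t → s ≢ t → Agrees x y s → Agrees x y t →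
                              TwoIn L (Separating x y)
    from-two-non-separators x y ne nh s t s≢t zs zt with same-foot s t s≢t (agree-at-one-foot s t ne nh zs zt)
    ... | inj₁ fA = two-in-map (λ σ fσ zσ → fσ (trans (agree-at-one-foot σ s ne nh zσ zs) fA)) two-off-u
    ... | inj₂ fAp = two-in-map (λ σ fσ zσ → fσ (trans (agree-at-one-foot σ s ne nh zσ zs) fAp)) two-off-v

    -- Non-hanging pairs: at least two of three landmarks separate, or two fail.
    non-hanging-case : ∀ x y → x ≢ y → ¬ HangingNbrs x y → TwoIn L (Separating x y)
    non-hanging-case x y ne nh with three-landmarks
    ... | α , β , γ , α≢β , α≢γ , β≢γ , hα , hβ , hγ
        with E x (f α) ≟ E y (f α) | E x (f β) ≟ E y (f β) | E x (f γ) ≟ E y (f γ)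
    ... | no sα | no sβ | _ = α , β , α≢β , hα , hβ , sα , sβ
    ... | no sα | yes _ | no sγ = α , γ , α≢γ , hα , hγ , sα , sγ
    ... | yes _ | no sβ | no sγ = β , γ , β≢γ , hβ , hγ , sβ , sγ
    ... | yes zα | yes zβ | _ = from-two-non-separators x y ne nh α β α≢β zα zβ
    ... | yes zα | no _ | yes zγ = from-two-non-separators x y ne nh α γ α≢γ zα zγ
    ... | no _ | yes zβ | yes zγ = from-two-non-separators x y ne nh β γ β≢γ zβ zγ

    separating : ∀ x y → x ∉ L → y ∉ L → x ≢ y → TwoIn L (Separating x y)
    separating x y hx hy ne with hanging? x y
    ... | yes hn = hanging-case x y hx hy hn
    ... | no nh = non-hanging-case x y ne nh

    landmark : Landmark L
    landmark x y hx hy ne with separating x y hx hy ne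
    ... | α , β , α≢β , hα , hβ , sα , sβ =
          α , β , α≢β , hα , hβ , separates-if (∉≢∈ {L} hx hα) (∉≢∈ {L} hy hα) sα , separates-if (∉≢∈ {L} hx hβ) (∉≢∈ {L} hy hβ) sβ

  -- 9. Minimal landmark sets
  --
  -- In each forbidden configuration some vertex w of L can be deleted from
  -- both local sets of §7 without destroying them; by §8, L minus w is then
  -- a smaller landmark set.

  module Minimal (L : Subset) (ML : MinimalLandmark L) where
    open LandmarkToLocalV L (proj₁ ML) using () renaming (S to Sv; local to localV; inS to inSv; mod-type to modV)
    open LandmarkToLocalU L (proj₁ ML) using () renaming (S to Su; local to localU; inS to inSu; mod-type to modU)

    -- No vertex of L can be deleted while keeping both local sets: L minus
    -- w would be a landmark set (§8) strictly inside L.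
    not-superfluous : ∀ w → w ∈ L → IsLocal v b vleg InModV posModV p (delete w Sv) →
                      IsLocal u a uleg InModU posModU p (delete w Su) → ⊥
    not-superfluous w hw lv lu = true≢false (trans (sym (proj₂ ML (delete w L) (delete-⊆ w L) smaller w hw)) (delete-self w L))
      where
      smaller : Landmark (delete w L)
      smaller = LocalToLandmark.landmark (delete w L) (delete w Sv) (delete w Su)
                  (delete-mono w Sv L (delete-⊆ v L)) lv (delete-mono w Su L (delete-⊆ u L)) lu

    keeps-local-v : ∀ w → (∀ k → StdTransfer Sv (delete w Sv) (vleg k)) → ModTypes (delete w Sv) InModV posModV p →
      (ModLeg.TypeM1 (delete w Sv) InModV posModV p → ModLeg.TypeM1 Sv InModV posModV p) →
      IsLocal v b vleg InModV posModV p (delete w Sv)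
    keeps-local-v w = local-transfer v b vleg InModV posModV p Sv (delete w Sv) localV (delete-∉ w Sv v (delete-self v L))

    keeps-local-u : ∀ w → (∀ k → StdTransfer Su (delete w Su) (uleg k)) → ModTypes (delete w Su) InModU posModU p →
      (ModLeg.TypeM1 (delete w Su) InModU posModU p → ModLeg.TypeM1 Su InModU posModU p) →
      IsLocal u a uleg InModU posModU p (delete w Su)
    keeps-local-u w = local-transfer u a uleg InModU posModU p Su (delete w Su) localU (delete-∉ w Su u (delete-self u L))

    untouched : ∀ {n} (leg : Fin n → V) S w → (∀ j → leg j ≢ w) → StdTransfer S (delete w S) leg
    untouched leg S w ne = std-unchanged leg S (delete w S) (λ j → delete-other w S (leg j) (ne j))

    -- Two interior path vertices: deleting one of them keeps both modified
    -- legs admissible (mod-delete-near).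
    interior : AtMostOneInterior L
    interior i i' 0<i i<p 0<i' i'<p hi hi' with i ≟F i'
    ... | yes e = e
    ... | no i≢i' = ⊥-elim (not-superfluous w hi
            (keeps-local-v w (λ k → untouched (vleg k) Sv w (λ j ())) (proj₁ mv) (λ m → ⊥-elim (proj₂ mv m)))
            (keeps-local-u w (λ k → untouched (uleg k) Su w (λ j ())) (proj₁ mu) (λ m → ⊥-elim (proj₂ mu m))))
      where
      w : V
      w = path i
      i'≢w : path i' ≢ w
      i'≢w e = i≢i' (sym (path-inj e))
      mv : ModTypes (delete w Sv) InModV posModV p × ¬ ModLeg.TypeM1 (delete w Sv) InModV posModV p
      mv = mod-delete-near InModV posModV p Sv w (path i') modV (inSv (path i') hi' i'<p) i'<p i'≢w (inSv w hi i<p) i<p (posV-path i) (posV-path i')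
      mu : ModTypes (delete w Su) InModU posModU p × ¬ ModLeg.TypeM1 (delete w Su) InModU posModU p
      mu = mod-delete-near InModU posModU p Su w (path i') modU (inSu (path i') hi' 0<i') 0<i' i'≢w (inSu w hi 0<i) 0<i (posU-path i) (posU-path i')

    -- Three vertices on a long leg of u: delete the outermost one w.  The
    -- leg keeps two vertices for u's local set, and v's modified leg keeps
    -- an admissible type (mod-delete-far).
    two-on-u-leg : ∀ k → 2 ≤ a k → AtMostTwo (uleg k) L
    two-on-u-leg k _ = at-most-two (λ j → uleg k j ∈ L) no-three
      where
      no-three : ∀ m r1 r2 → uleg k m ∈ L → uleg k r1 ∈ L → uleg k r2 ∈ L → r1 ≢ r2 → toℕ r1 < toℕ m → toℕ r2 < toℕ m → ⊥
      no-three m r1 r2 hm hr1 hr2 r1≢r2 l1 l2 = not-superfluous w hm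
          (keeps-local-v w (λ k' → untouched (vleg k') Sv w (λ j ())) (proj₁ mv) (λ m → ⊥-elim (proj₂ mv m)))
          (keeps-local-u w legs (proj₁ mu modU) (proj₂ mu))
        where
        w : V
        w = uleg k m
        r1≢w : uleg k r1 ≢ w
        r1≢w e = fin-<⇒≢ l1 (uleg-j e)
        r2≢w : uleg k r2 ≢ w
        r2≢w e = fin-<⇒≢ l2 (uleg-j e)
        legs : ∀ k' → StdTransfer Su (delete w Su) (uleg k')
        legs k' = by-leg k' (k' ≟F k)
          where
          by-leg : ∀ k' → Dec (k' ≡ k) → StdTransfer Su (delete w Su) (uleg k')
          by-leg k' (yes e) = subst (λ k'' → StdTransfer Su (delete w Su) (uleg k'')) (sym e)
                                (std-keeps-two (uleg k) Su (delete w Su) r1 r2 r1≢r2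
                                  (delete-∈ w Su _ r1≢w hr1) (delete-∈ w Su _ r2≢w hr2) hr1 hr2)
          by-leg k' (no k'≢k) = untouched (uleg k') Su w (λ j e → k'≢k (uleg-k e))
        mu : (ModTypes Su InModU posModU p → ModTypes (delete w Su) InModU posModU p)
             × (ModLeg.TypeM1 (delete w Su) InModU posModU p → ModLeg.TypeM1 Su InModU posModU p)
        mu = mod-unchanged InModU posModU p Su (delete w Su) (λ x ix → delete-other w Su x (λ e → subst InModU e ix))
        mv : ModTypes (delete w Sv) InModV posModV p × ¬ ModLeg.TypeM1 (delete w Sv) InModV posModV p
        mv = mod-delete-far InModV posModV p Sv w (uleg k r1) (uleg k r2) modV (λ e → r1≢r2 (uleg-j e)) hr1 hr2 tt tt r1≢w r2≢w
               (posV-beyond-head k m (m<n⇒n≢0 l1)) (posV-uleg k r1) (posV-uleg k r2)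

    two-on-v-leg : ∀ k → 2 ≤ b k → AtMostTwo (vleg k) L
    two-on-v-leg k _ = at-most-two (λ j → vleg k j ∈ L) no-three
      where
      no-three : ∀ m r1 r2 → vleg k m ∈ L → vleg k r1 ∈ L → vleg k r2 ∈ L → r1 ≢ r2 → toℕ r1 < toℕ m → toℕ r2 < toℕ m → ⊥
      no-three m r1 r2 hm hr1 hr2 r1≢r2 l1 l2 = not-superfluous w hm
          (keeps-local-v w legs (proj₁ mv modV) (proj₂ mv))
          (keeps-local-u w (λ k' → untouched (uleg k') Su w (λ j ())) (proj₁ mu) (λ m → ⊥-elim (proj₂ mu m)))
        where
        w : V
        w = vleg k m
        r1≢w : vleg k r1 ≢ w
        r1≢w e = fin-<⇒≢ l1 (vleg-j e)
        r2≢w : vleg k r2 ≢ w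
        r2≢w e = fin-<⇒≢ l2 (vleg-j e)
        legs : ∀ k' → StdTransfer Sv (delete w Sv) (vleg k')
        legs k' = by-leg k' (k' ≟F k)
          where
          by-leg : ∀ k' → Dec (k' ≡ k) → StdTransfer Sv (delete w Sv) (vleg k')
          by-leg k' (yes e) = subst (λ k'' → StdTransfer Sv (delete w Sv) (vleg k'')) (sym e)
                                (std-keeps-two (vleg k) Sv (delete w Sv) r1 r2 r1≢r2
                                  (delete-∈ w Sv _ r1≢w hr1) (delete-∈ w Sv _ r2≢w hr2) hr1 hr2)
          by-leg k' (no k'≢k) = untouched (vleg k') Sv w (λ j e → k'≢k (vleg-k e))
        mv : (ModTypes Sv InModV posModV p → ModTypes (delete w Sv) InModV posModV p)
             × (ModLeg.TypeM1 (delete w Sv) InModV posModV p → ModLeg.TypeM1 Sv InModV posModV p)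
        mv = mod-unchanged InModV posModV p Sv (delete w Sv) (λ x ix → delete-other w Sv x (λ e → subst InModV e ix))
        mu : ModTypes (delete w Su) InModU posModU p × ¬ ModLeg.TypeM1 (delete w Su) InModU posModU p
        mu = mod-delete-far InModU posModU p Su w (vleg k r1) (vleg k r2) modU (λ e → r1≢r2 (vleg-j e)) hr1 hr2 tt tt r1≢w r2≢w
               (posU-beyond-head k m (m<n⇒n≢0 l1)) (posU-vleg k r1) (posU-vleg k r2)

short-leg : ∀ (c : Fin 2 → ℕ) → (c fzero ≡ 1 ⊎ c (fsuc fzero) ≡ 1) → Σ (Fin 2) λ k → c k ≡ 1
short-leg c (inj₁ e) = fzero , e
short-leg c (inj₂ e) = fsuc fzero , e

lemma9 : (p : ℕ) (a b : Fin 2 → ℕ) → 1 ≤ p →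
    (∀ k → 1 ≤ a k) → (∀ k → 1 ≤ b k) →
    (a fzero ≡ 1 ⊎ a (fsuc fzero) ≡ 1) → (b fzero ≡ 1 ⊎ b (fsuc fzero) ≡ 1) →
    let open TwoCoreTree p a b in
    (∀ (L : Subset) → Landmark L ⇔ (ContainsLocalV L × ContainsLocalU L))
    × (∀ (L : Subset) → MinimalLandmark L →
         AtMostOneInterior L
         × (∀ k → 2 ≤ a k → AtMostTwo (uleg k) L)
         × (∀ k → 2 ≤ b k → AtMostTwo (vleg k) L))
lemma9 p a b hp ha hb sa sb with short-leg a sa | short-leg b sb
... | ku , hku | kv , hkv = (λ L → mk⇔ (local-sets L) (landmark L)) , minimal
  where
  open TwoCoreTree p a b
  open Caterpillar p a b hp ha hb ku kv hku hkv

  local-sets : ∀ L → Landmark L → ContainsLocalV L × ContainsLocalU L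
  local-sets L lm = (delete v L , delete-⊆ v L , LandmarkToLocalV.local L lm)
                  , (delete u L , delete-⊆ u L , LandmarkToLocalU.local L lm)

  landmark : ∀ L → ContainsLocalV L × ContainsLocalU L → Landmark L
  landmark L ((Sv , Sv⊆L , locV) , (Su , Su⊆L , locU)) = LocalToLandmark.landmark L Sv Su Sv⊆L locV Su⊆L locU

  minimal : ∀ L → MinimalLandmark L → AtMostOneInterior L × (∀ k → 2 ≤ a k → AtMostTwo (uleg k) L) × (∀ k → 2 ≤ b k → AtMostTwo (vleg k) L)
  minimal L ml = interior , two-on-u-leg , two-on-v-leg
    where open Minimal L ml
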